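{- Fix $t\in\mathbb{N}$ and let $M$ be the matroid union $M_1\vee M_2\vee\cdots\vee M_k$ with $k\geq 1$ (all $M_i$ on the ground set $E(M)$). For each $i\in[k]$ and $j\in[t]$, let $M_{i,j}$ be the matroid on $S_{E(M)}$ obtained from $M_i$ by, for each $e\in E(M)$, adding each element of $S_e-e$ parallel to $e$ if $r_{M_i}(e)=1$, or as a loop if $r_{M_i}(e)=0$. Then $M^t=\bigvee_{i\in[k],\,j\in[t]}M_{i,j}$.
   Context: A cyclic flat of a matroid $M$ is a flat $F$ such that $M|F$ has no coloops; $\mathcal{Z}(M)$ denotes the set of cyclic flats, and a matroid is determined by its cyclic flats and their ranks. The $t$-expansion: fix $t\in\mathbb{N}$; for each $e\in E(M)$ let $S_e$ be a $t$-element set with $e\in S_e$, the sets $S_e$ pairwise disjoint; for $X\subseteq E(M)$ let $S_X=\bigcup_{e\in X}S_e$. The $t$-expansion $M^t$ is the matroid on $S_{E(M)}$ whose cyclic flats are exactly the sets $S_A$ with $A\in\mathcal{Z}(M)$, with $r_{M^t}(S_A)=t\cdot r_M(A)$. The matroid union $N_1\vee\cdots\vee N_m$ of matroids on a common set $E$ is the matroid on $E$ whose independent sets are the sets $I_1\cup\cdots\cup I_m$ with $I_j$ independent in $N_j$. $[k]=\{1,\dots,k\}$. -}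

module Defs where

open import Data.Nat using (ℕ; suc; _≤_; _<_; _*_)
open import Data.Fin using (Fin; quotient)
open import Data.Fin.Subset using (Subset; ⊥; _∈_; _∉_; _⊆_; _∩_; _∪_; _-_; ∣_∣; ⁅_⁆)
open import Data.Vec using (tabulate; lookup)
open import Data.Product using (Σ; ∃; _×_; _,_)
open import Relation.Nullary using (¬_)
open import Relation.Unary using (Decidable)
open import Function.Bundles using (_⇔_)
open import Relation.Binary.PropositionalEquality using (_≡_)

IndepSys : ℕ → Set₁
IndepSys n = Subset n → Set

record Matroid (n : ℕ) : Set₁ where
  field
    Indep       : IndepSys n
    indep?      : Decidable Indep
    indep-∅     : Indep ⊥
    indep-⊆     : ∀ {I J} → J ⊆ I → Indep I → Indep J
    indep-aug   : ∀ {I J} → Indep I → Indep J → ∣ I ∣ < ∣ J ∣ →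
                  ∃ λ e → e ∈ J × e ∉ I × Indep (I ∪ ⁅ e ⁆)
open Matroid public

Rank : ∀ {n} → IndepSys n → Subset n → ℕ → Set
Rank Ind X k = (∃ λ I → I ⊆ X × Ind I × ∣ I ∣ ≡ k) × (∀ I → I ⊆ X → Ind I → ∣ I ∣ ≤ k)

BasisOf : ∀ {n} → IndepSys n → Subset n → Subset n → Set
BasisOf Ind F B = B ⊆ F × Ind B × (∀ J → B ⊆ J → J ⊆ F → Ind J → J ⊆ B)

ColoopOfRestriction : ∀ {n} → IndepSys n → Subset n → Fin n → Set
ColoopOfRestriction Ind F e = e ∈ F × (∀ B → BasisOf Ind F B → e ∈ B)

Flat : ∀ {n} → IndepSys n → Subset n → Set
Flat Ind F = ∀ e → e ∉ F → ∀ k k′ → Rank Ind F k → Rank Ind (F ∪ ⁅ e ⁆) k′ → k < k′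

CyclicFlat : ∀ {n} → IndepSys n → Subset n → Set
CyclicFlat Ind F = Flat Ind F × (∀ e → ¬ ColoopOfRestriction Ind F e)

UnionIndep : ∀ {n} {ι : Set} → (ι → IndepSys n) → IndepSys n
UnionIndep {n} {ι} N X =
  Σ (ι → Subset n) λ Is → (∀ j → N j (Is j)) × (∀ x → (x ∈ X) ⇔ (∃ λ j → x ∈ Is j))

-- Expanded ground set S_{E} = Fin (n * t): element x belongs to S_e for e = quotient t x
-- (so S_e = { combine e j | j : Fin t }, a t-element set).
base : ∀ {n} t → Fin (n * t) → Fin n
base t x = quotient t x

S : ∀ {n} t → Subset n → Subset (n * t)
S {n} t X = tabulate (λ x → lookup X (base {n} t x))

-- M_{i,j}: obtained from a matroid with independence predicate Ind on Fin n by adding,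
-- for each e, the elements of S_e - e parallel to e (if r(e) = 1) or as loops (if r(e) = 0).
-- Its independent sets are exactly the I ⊆ S_E meeting each S_e at most once whose
-- "shadow" {e | I ∩ S_e ≠ ∅} is independent in the original matroid.
ParallelLoopExt : ∀ {n} t → IndepSys n → IndepSys (n * t)
ParallelLoopExt {n} t Ind I =
  (∀ x y → x ∈ I → y ∈ I → base {n} t x ≡ base {n} t y → x ≡ y) ×
  (∃ λ J → (∀ e → (e ∈ J) ⇔ (∃ λ x → x ∈ I × base {n} t x ≡ e)) × Ind J)

IsExpansion : ∀ {n} t → IndepSys n → IndepSys (n * t) → Set
IsExpansion {n} t M N =
  (∀ F → CyclicFlat N F ⇔ (∃ λ A → CyclicFlat M A × F ≡ S {n} t A)) ×
  (∀ A → CyclicFlat M A → ∀ k → Rank M A k → Rank N (S {n} t A) (t * k))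

{-# OPTIONS --safe #-}

-- Edmonds' augmenting-path algorithm yields, for every X, a maximum set independent in the union
-- M = M₁ ∨ ⋯ ∨ Mₖ, split into disjoint parts Iᵢ, together with a certificate of optimality: a set R
-- such that X ─ R is covered and every Iᵢ ∩ R is a maximum Mᵢ-independent subset of R. The elements
-- of S_e are parallel copies (or loops) of e in every M_{i,j}, so the same certificate bounds the
-- union N = ⋁ M_{i,j} on S_X, while expanding the parts Iᵢ gives the matching lower bound; hence
-- r_N(S_X) = t · r_M(X). The algorithm also shows that maximal union-independent sets are maximum,
-- so bases of M|A expand to bases of N|S_A, and flatness and coloop-freeness transfer in both
-- directions. Finally a cyclic flat F of N is a union of fibres S_e: transposing two parallel
-- elements shows that an element of F sharing its fibre with an element outside F is a coloop of N|F.

module Submission where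

open import Defs
open import Data.Nat using (ℕ; zero; suc; _+_; _*_; _≤_; _<_; z≤n; s≤s)
open import Data.Nat.Properties
open import Data.Unit using (⊤; tt)
open import Data.Bool using (true; false)
open import Data.Fin using (Fin; zero; suc; _↑ˡ_; _↑ʳ_; combine; quotient; remainder)
open import Data.Fin.Properties
  using (any?; all?; splitAt-↑ˡ; splitAt-↑ʳ; remQuot-combine; combine-remQuot; *↔×) renaming (_≟_ to _≟ᶠ_)
open import Data.Fin.Permutation.Components using (transpose; transpose-inverse)
open import Data.Fin.Subset
  using (Subset; ⊥; _∈_; _∉_; _⊆_; _∩_; _∪_; _─_; _-_; ∣_∣; ⁅_⁆; Empty; Nonempty)
open import Data.Fin.Subset.Properties
open import Data.Vec using ([]; _∷_; tabulate; lookup; replicate; allFin; here; there)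
open import Data.Vec.Properties
  using (lookup∘tabulate; []=⇒lookup; lookup⇒[]=; tabulate-cong; tabulate-allFin; map-const)
open import Data.Vec.Functional using (updateAt)
open import Data.Vec.Functional.Properties using (updateAt-updates; updateAt-minimal)
open import Data.Product using (∃; _×_; _,_; proj₁; proj₂)
open import Data.Sum using (_⊎_; inj₁; inj₂; [_,_]′)
open import Data.Empty using (⊥-elim)
open import Function using (id; _∘_)
open import Function.Bundles using (_⇔_; mk⇔; Equivalence; _↔_; Inverse)
open import Function.Properties.Equivalence using () renaming (sym to ⇔-sym)
open import Relation.Nullary using (Dec; yes; no; ¬_; does)
open import Relation.Nullary.Decidable using (_×-dec_; _⊎-dec_; ¬?; _→-dec_; map′)
open import Relation.Unary using (Decidable)
open import Relation.Binary.PropositionalEquality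
open import Algebra.Properties.Semiring.Sum +-*-semiring using (sum; sum-syntax; sum-cong-≗; *-distribˡ-sum)

private variable
  n m : ℕ
  x y : Fin n
  p q : Subset n

-- Finite subsets and families of subsets

∪⁺ˡ : ∀ q → x ∈ p → x ∈ p ∪ q
∪⁺ˡ q = p⊆p∪q q

∪⁺ʳ : ∀ p → x ∈ q → x ∈ p ∪ q
∪⁺ʳ p = q⊆p∪q p _

∪⁻ : ∀ p q → x ∈ p ∪ q → x ∈ p ⊎ x ∈ q
∪⁻ = x∈p∪q⁻

∩⁺ : x ∈ p → x ∈ q → x ∈ p ∩ q
∩⁺ x∈p x∈q = x∈p∩q⁺ (x∈p , x∈q)

─⁺ : x ∈ p → x ∉ q → x ∈ p ─ q
─⁺ = x∈p∧x∉q⇒x∈p─q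

─⁻ˡ : ∀ p q → x ∈ p ─ q → x ∈ p
─⁻ˡ p q = p─q⊆p p q

─⁻ʳ : ∀ p q → x ∈ p ─ q → x ∉ q
─⁻ʳ (_ ∷ p) (true  ∷ q) ()   here
─⁻ʳ (_ ∷ p) (false ∷ q) here  ()
─⁻ʳ (_ ∷ p) (_     ∷ q) (there x∈p─q) (there x∈q) = ─⁻ʳ p q x∈p─q x∈q

-⁺ : x ∈ p → x ≢ y → x ∈ p - y
-⁺ = x∈p∧x≢y⇒x∈p-y

-⁻ˡ : ∀ p y → x ∈ p - y → x ∈ p
-⁻ˡ p y = p─q⊆p p ⁅ y ⁆

-⁻ʳ : ∀ p y → x ∈ p - y → x ≢ y
-⁻ʳ p y x∈p-y refl = ─⁻ʳ p ⁅ y ⁆ x∈p-y (x∈⁅x⁆ y)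

⁅⁆⁺ˡ : ∀ y → x ∈ p → x ∈ p ∪ ⁅ y ⁆
⁅⁆⁺ˡ y = ∪⁺ˡ ⁅ y ⁆

⁅⁆⁺ʳ : ∀ (p : Subset n) y → y ∈ p ∪ ⁅ y ⁆
⁅⁆⁺ʳ p y = ∪⁺ʳ p (x∈⁅x⁆ y)

⁅⁆⁻ : ∀ p y → x ∈ p ∪ ⁅ y ⁆ → x ∈ p ⊎ x ≡ y
⁅⁆⁻ p y x∈ = [ inj₁ , inj₂ ∘ x∈⁅y⁆⇒x≡y y ]′ (∪⁻ p ⁅ y ⁆ x∈)

⊆-or-witness : ∀ (p q : Subset n) → p ⊆ q ⊎ ∃ λ x → x ∈ p × x ∉ q
⊆-or-witness p q with any? (λ x → (x ∈? p) ×-dec ¬? (x ∈? q))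
... | yes witness = inj₂ witness
... | no ¬witness = inj₁ λ {x} x∈p → decidable-stable x x∈p
  where
  decidable-stable : ∀ x → x ∈ p → x ∈ q
  decidable-stable x x∈p with x ∈? q
  ... | yes x∈q = x∈q
  ... | no  x∉q = ⊥-elim (¬witness (x , x∈p , x∉q))

subset : ∀ {P : Fin n → Set} → Decidable P → Subset n
subset P? = tabulate (does ∘ P?)

subset⁺ : ∀ {P : Fin n → Set} (P? : Decidable P) → P x → x ∈ subset P?
subset⁺ {x = x} P? px with P? x in eq
... | yes _ = lookup⇒[]= x _ (trans (lookup∘tabulate _ x) (cong does eq))
... | no ¬px = ⊥-elim (¬px px)

subset⁻ : ∀ {P : Fin n → Set} (P? : Decidable P) → x ∈ subset P? → P x
subset⁻ {x = x} P? x∈ with P? x | trans (sym (lookup∘tabulate (does ∘ P?) x)) ([]=⇒lookup x∈)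
... | yes px | _ = px
... | no  _  | ()

∣p∣≡∣p∩q∣+∣p─q∣ : ∀ (p q : Subset n) → ∣ p ∣ ≡ ∣ p ∩ q ∣ + ∣ p ─ q ∣
∣p∣≡∣p∩q∣+∣p─q∣ []          []          = refl
∣p∣≡∣p∩q∣+∣p─q∣ (true  ∷ p) (true  ∷ q) = cong suc (∣p∣≡∣p∩q∣+∣p─q∣ p q)
∣p∣≡∣p∩q∣+∣p─q∣ (true  ∷ p) (false ∷ q) = trans (cong suc (∣p∣≡∣p∩q∣+∣p─q∣ p q)) (sym (+-suc _ _))
∣p∣≡∣p∩q∣+∣p─q∣ (false ∷ p) (true  ∷ q) = ∣p∣≡∣p∩q∣+∣p─q∣ p q
∣p∣≡∣p∩q∣+∣p─q∣ (false ∷ p) (false ∷ q) = ∣p∣≡∣p∩q∣+∣p─q∣ p q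

∣p∪q∣+∣p∩q∣≡∣p∣+∣q∣ : ∀ (p q : Subset n) → ∣ p ∪ q ∣ + ∣ p ∩ q ∣ ≡ ∣ p ∣ + ∣ q ∣
∣p∪q∣+∣p∩q∣≡∣p∣+∣q∣ []          []          = refl
∣p∪q∣+∣p∩q∣≡∣p∣+∣q∣ (true  ∷ p) (true  ∷ q) =
  cong suc (trans (+-suc _ _) (trans (cong suc (∣p∪q∣+∣p∩q∣≡∣p∣+∣q∣ p q)) (sym (+-suc _ _))))
∣p∪q∣+∣p∩q∣≡∣p∣+∣q∣ (true  ∷ p) (false ∷ q) = cong suc (∣p∪q∣+∣p∩q∣≡∣p∣+∣q∣ p q)
∣p∪q∣+∣p∩q∣≡∣p∣+∣q∣ (false ∷ p) (true  ∷ q) = trans (cong suc (∣p∪q∣+∣p∩q∣≡∣p∣+∣q∣ p q)) (sym (+-suc _ _))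
∣p∪q∣+∣p∩q∣≡∣p∣+∣q∣ (false ∷ p) (false ∷ q) = ∣p∪q∣+∣p∩q∣≡∣p∣+∣q∣ p q

∣p∪q∣≤∣p∣+∣q∣ : ∀ (p q : Subset n) → ∣ p ∪ q ∣ ≤ ∣ p ∣ + ∣ q ∣
∣p∪q∣≤∣p∣+∣q∣ p q = subst (∣ p ∪ q ∣ ≤_) (∣p∪q∣+∣p∩q∣≡∣p∣+∣q∣ p q) (m≤m+n _ _)

Empty⇒∣p∣≡0 : Empty p → ∣ p ∣ ≡ 0
Empty⇒∣p∣≡0 {n} empty = trans (cong ∣_∣ (Empty-unique empty)) (∣⊥∣≡0 n)

0<∣p∣⇒Nonempty : ∀ (p : Subset n) → 0 < ∣ p ∣ → Nonempty p
0<∣p∣⇒Nonempty p 0<∣p∣ with nonempty? p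
... | yes nonempty = nonempty
... | no  empty    = ⊥-elim (<-irrefl (sym (Empty⇒∣p∣≡0 empty)) 0<∣p∣)

Empty[p∩q]⇒∣p∪q∣≡∣p∣+∣q∣ : ∀ (p q : Subset n) → Empty (p ∩ q) → ∣ p ∪ q ∣ ≡ ∣ p ∣ + ∣ q ∣
Empty[p∩q]⇒∣p∪q∣≡∣p∣+∣q∣ p q empty = begin
  ∣ p ∪ q ∣               ≡⟨ +-identityʳ _ ⟨
  ∣ p ∪ q ∣ + 0           ≡⟨ cong (∣ p ∪ q ∣ +_) (Empty⇒∣p∣≡0 empty) ⟨
  ∣ p ∪ q ∣ + ∣ p ∩ q ∣   ≡⟨ ∣p∪q∣+∣p∩q∣≡∣p∣+∣q∣ p q ⟩
  ∣ p ∣ + ∣ q ∣           ∎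
  where open ≡-Reasoning

x∉p⇒∣p∪⁅x⁆∣≡1+∣p∣ : ∀ (p : Subset n) x → x ∉ p → ∣ p ∪ ⁅ x ⁆ ∣ ≡ suc ∣ p ∣
x∉p⇒∣p∪⁅x⁆∣≡1+∣p∣ p x x∉p = begin
  ∣ p ∪ ⁅ x ⁆ ∣       ≡⟨ Empty[p∩q]⇒∣p∪q∣≡∣p∣+∣q∣ p ⁅ x ⁆ disjoint ⟩
  ∣ p ∣ + ∣ ⁅ x ⁆ ∣   ≡⟨ cong (∣ p ∣ +_) (∣⁅x⁆∣≡1 x) ⟩
  ∣ p ∣ + 1           ≡⟨ +-comm ∣ p ∣ 1 ⟩
  suc ∣ p ∣           ∎
  where
  open ≡-Reasoning
  disjoint : Empty (p ∩ ⁅ x ⁆)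
  disjoint (y , y∈p∩⁅x⁆) with x∈p∩q⁻ p ⁅ x ⁆ y∈p∩⁅x⁆
  ... | y∈p , y∈⁅x⁆ = x∉p (subst (_∈ p) (x∈⁅y⁆⇒x≡y x y∈⁅x⁆) y∈p)

∣p∪⁅x⁆∣≤1+∣p∣ : ∀ (p : Subset n) x → ∣ p ∪ ⁅ x ⁆ ∣ ≤ suc ∣ p ∣
∣p∪⁅x⁆∣≤1+∣p∣ p x = subst (∣ p ∪ ⁅ x ⁆ ∣ ≤_) (trans (cong (∣ p ∣ +_) (∣⁅x⁆∣≡1 x)) (+-comm ∣ p ∣ 1))
                           (∣p∪q∣≤∣p∣+∣q∣ p ⁅ x ⁆)

x∈p⇒1+∣p-x∣≡∣p∣ : ∀ (p : Subset n) x → x ∈ p → suc ∣ p - x ∣ ≡ ∣ p ∣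
x∈p⇒1+∣p-x∣≡∣p∣ p x x∈p = sym (begin
  ∣ p ∣                       ≡⟨ ∣p∣≡∣p∩q∣+∣p─q∣ p ⁅ x ⁆ ⟩
  ∣ p ∩ ⁅ x ⁆ ∣ + ∣ p - x ∣   ≡⟨ cong (λ s → ∣ s ∣ + ∣ p - x ∣) p∩⁅x⁆≡⁅x⁆ ⟩
  ∣ ⁅ x ⁆ ∣ + ∣ p - x ∣       ≡⟨ cong (_+ ∣ p - x ∣) (∣⁅x⁆∣≡1 x) ⟩
  suc ∣ p - x ∣               ∎)
  where
  open ≡-Reasoning
  p∩⁅x⁆≡⁅x⁆ : p ∩ ⁅ x ⁆ ≡ ⁅ x ⁆
  p∩⁅x⁆≡⁅x⁆ = ⊆-antisym (p∩q⊆q p ⁅ x ⁆)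
    (λ y∈⁅x⁆ → ∩⁺ (subst (_∈ p) (sym (x∈⁅y⁆⇒x≡y x y∈⁅x⁆)) x∈p) y∈⁅x⁆)

p⊆q∧∣q∣≤∣p∣⇒q⊆p : ∀ (p q : Subset n) → p ⊆ q → ∣ q ∣ ≤ ∣ p ∣ → q ⊆ p
p⊆q∧∣q∣≤∣p∣⇒q⊆p p q p⊆q ∣q∣≤∣p∣ with ⊆-or-witness q p
... | inj₁ q⊆p = q⊆p
... | inj₂ (x , x∈q , x∉p) = ⊥-elim (<⇒≱ (p⊂q⇒∣p∣<∣q∣ (p⊆q , x , x∈q , x∉p)) ∣q∣≤∣p∣)

∑-mono-≤ : ∀ {f g : Fin m → ℕ} → (∀ i → f i ≤ g i) → sum f ≤ sum g
∑-mono-≤ {zero}  f≤g = z≤n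
∑-mono-≤ {suc m} f≤g = +-mono-≤ (f≤g zero) (∑-mono-≤ (f≤g ∘ suc))

∑-const : ∀ m c → ∑[ i < m ] c ≡ m * c
∑-const zero    c = refl
∑-const (suc m) c = cong (c +_) (∑-const m c)

⋃ᶠ : (Fin m → Subset n) → Subset n
⋃ᶠ {zero}  F = ⊥
⋃ᶠ {suc m} F = F zero ∪ ⋃ᶠ (F ∘ suc)

⋃ᶠ⁺ : ∀ (F : Fin m → Subset n) i → x ∈ F i → x ∈ ⋃ᶠ F
⋃ᶠ⁺ {suc m} F zero    x∈F₀ = ∪⁺ˡ (⋃ᶠ (F ∘ suc)) x∈F₀
⋃ᶠ⁺ {suc m} F (suc i) x∈Fᵢ = ∪⁺ʳ (F zero) (⋃ᶠ⁺ (F ∘ suc) i x∈Fᵢ)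

⋃ᶠ⁻ : ∀ (F : Fin m → Subset n) → x ∈ ⋃ᶠ F → ∃ λ i → x ∈ F i
⋃ᶠ⁻ {zero}  F x∈⊥ = ⊥-elim (∉⊥ x∈⊥)
⋃ᶠ⁻ {suc m} F x∈⋃ with ∪⁻ (F zero) _ x∈⋃
... | inj₁ x∈F₀ = zero , x∈F₀
... | inj₂ x∈⋃′ with ⋃ᶠ⁻ (F ∘ suc) x∈⋃′
...   | i , x∈Fᵢ = suc i , x∈Fᵢ

∣⋃ᶠ∣≤∑ : ∀ (F : Fin m → Subset n) → ∣ ⋃ᶠ F ∣ ≤ ∑[ i < m ] ∣ F i ∣
∣⋃ᶠ∣≤∑ {zero}  {n} F = ≤-reflexive (∣⊥∣≡0 n)
∣⋃ᶠ∣≤∑ {suc m}     F = ≤-trans (∣p∪q∣≤∣p∣+∣q∣ (F zero) _) (+-monoʳ-≤ ∣ F zero ∣ (∣⋃ᶠ∣≤∑ (F ∘ suc)))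

Disjoint : (Fin m → Subset n) → Set
Disjoint F = ∀ i j {x} → x ∈ F i → x ∈ F j → i ≡ j

Disjoint⇒∣⋃ᶠ∣≡∑ : ∀ (F : Fin m → Subset n) → Disjoint F → ∣ ⋃ᶠ F ∣ ≡ ∑[ i < m ] ∣ F i ∣
Disjoint⇒∣⋃ᶠ∣≡∑ {zero}  {n} F _ = ∣⊥∣≡0 n
Disjoint⇒∣⋃ᶠ∣≡∑ {suc m}     F disjoint =
  trans (Empty[p∩q]⇒∣p∪q∣≡∣p∣+∣q∣ (F zero) _ head-apart)
        (cong (∣ F zero ∣ +_) (Disjoint⇒∣⋃ᶠ∣≡∑ (F ∘ suc) tail-disjoint))
  where
  head-apart : Empty (F zero ∩ ⋃ᶠ (F ∘ suc))
  head-apart (x , x∈∩) with x∈p∩q⁻ (F zero) _ x∈∩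
  ... | x∈F₀ , x∈⋃ with ⋃ᶠ⁻ (F ∘ suc) x∈⋃
  ...   | i , x∈Fᵢ with disjoint zero (suc i) x∈F₀ x∈Fᵢ
  ...     | ()
  tail-disjoint : Disjoint (F ∘ suc)
  tail-disjoint i j x∈Fᵢ x∈Fⱼ = Data.Fin.Properties.suc-injective (disjoint (suc i) (suc j) x∈Fᵢ x∈Fⱼ)

⋃ᶠ-∩ : ∀ (F : Fin m → Subset n) r → ⋃ᶠ (λ i → F i ∩ r) ≡ ⋃ᶠ F ∩ r
⋃ᶠ-∩ {zero}  F r = sym (∩-zeroˡ r)
⋃ᶠ-∩ {suc m} F r = trans (cong (F zero ∩ r ∪_) (⋃ᶠ-∩ (F ∘ suc) r)) (sym (∩-distribʳ-∪ r (F zero) _))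

Disjoint⇒∑∣∩∣≡∣⋃ᶠ∩∣ : ∀ (F : Fin m → Subset n) r → Disjoint F → ∑[ i < m ] ∣ F i ∩ r ∣ ≡ ∣ ⋃ᶠ F ∩ r ∣
Disjoint⇒∑∣∩∣≡∣⋃ᶠ∩∣ F r disjoint =
  trans (sym (Disjoint⇒∣⋃ᶠ∣≡∑ (λ i → F i ∩ r) λ i j x∈ x∈′ → disjoint i j (p∩q⊆p _ r x∈) (p∩q⊆p _ r x∈′)))
        (cong ∣_∣ (⋃ᶠ-∩ F r))

disjointify : (Fin m → Subset n) → Fin m → Subset n
disjointify {suc m} F zero    = F zero
disjointify {suc m} F (suc i) = disjointify (λ j → F (suc j) ─ F zero) i

disjointify-⊆ : ∀ (F : Fin m → Subset n) i → disjointify F i ⊆ F i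
disjointify-⊆ {suc m} F zero    = id
disjointify-⊆ {suc m} F (suc i) = ─⁻ˡ (F (suc i)) (F zero) ∘ disjointify-⊆ (λ j → F (suc j) ─ F zero) i

disjointify-covers : ∀ (F : Fin m → Subset n) i → x ∈ F i → ∃ λ j → x ∈ disjointify F j
disjointify-covers {suc m} F zero x∈F₀ = zero , x∈F₀
disjointify-covers {suc m} {x = x} F (suc i) x∈Fᵢ with x ∈? F zero
... | yes x∈F₀ = zero , x∈F₀
... | no  x∉F₀ with disjointify-covers (λ j → F (suc j) ─ F zero) i (─⁺ x∈Fᵢ x∉F₀)
...   | j , x∈Dⱼ = suc j , x∈Dⱼ

disjointify-disjoint : ∀ (F : Fin m → Subset n) → Disjoint (disjointify F)
disjointify-disjoint {suc m} F zero    zero    _ _ = refl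
disjointify-disjoint {suc m} F zero    (suc j) x∈F₀ x∈Dⱼ =
  ⊥-elim (─⁻ʳ _ (F zero) (disjointify-⊆ (λ j → F (suc j) ─ F zero) j x∈Dⱼ) x∈F₀)
disjointify-disjoint {suc m} F (suc i) zero    x∈Dᵢ x∈F₀ =
  ⊥-elim (─⁻ʳ _ (F zero) (disjointify-⊆ (λ j → F (suc j) ─ F zero) i x∈Dᵢ) x∈F₀)
disjointify-disjoint {suc m} F (suc i) (suc j) x∈Dᵢ x∈Dⱼ =
  cong suc (disjointify-disjoint (λ j → F (suc j) ─ F zero) i j x∈Dᵢ x∈Dⱼ)

updateAt-elim : ∀ {A : Set} (P : Fin m → A → Set) (xs : Fin m → A) i {f : A → A} →
                P i (f (xs i)) → (∀ j → j ≢ i → P j (xs j)) → ∀ j → P j (updateAt xs i f j)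
updateAt-elim P xs i Pᵢ Pⱼ j with j ≟ᶠ i
... | yes refl = subst (P j) (sym (updateAt-updates j xs)) Pᵢ
... | no  j≢i  = subst (P j) (sym (updateAt-minimal j i xs j≢i)) (Pⱼ j j≢i)

infixl 8 _⟨_↦_⟩

_⟨_↦_⟩ : Subset n → Fin n → Fin n → Subset n
I ⟨ x ↦ y ⟩ = (I - x) ∪ ⁅ y ⁆

∪⁅⁆-mono : ∀ y → p ⊆ q → p ∪ ⁅ y ⁆ ⊆ q ∪ ⁅ y ⁆
∪⁅⁆-mono {p = p} y p⊆q x∈ = [ ⁅⁆⁺ˡ y ∘ p⊆q , (λ { refl → ⁅⁆⁺ʳ _ y }) ]′ (⁅⁆⁻ p y x∈)

⟨↦⟩-mono : ∀ x y → p ⊆ q → p ⟨ x ↦ y ⟩ ⊆ q ⟨ x ↦ y ⟩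
⟨↦⟩-mono {p = p} x y p⊆q = ∪⁅⁆-mono y (λ w∈ → -⁺ (p⊆q (-⁻ˡ p x w∈)) (-⁻ʳ p x w∈))

-- Exchange in a single matroid

module MatroidExchange (M : Matroid n) where

  private
    Ind : IndepSys n
    Ind = Indep M

  indep-extend : ∀ {J L} → Ind J → Ind L →
                 ∃ λ J′ → J ⊆ J′ × J′ ⊆ J ∪ L × Ind J′ × ∣ L ∣ ≤ ∣ J′ ∣
  indep-extend {J} {L} J-indep L-indep = go ∣ L ∣ J-indep (m≤m+n ∣ L ∣ ∣ J ∣)
    where
    go : ∀ fuel {J} → Ind J → ∣ L ∣ ≤ fuel + ∣ J ∣ →
         ∃ λ J′ → J ⊆ J′ × J′ ⊆ J ∪ L × Ind J′ × ∣ L ∣ ≤ ∣ J′ ∣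
    go fuel {J} J-indep bound with ∣ L ∣ ≤? ∣ J ∣
    ... | yes ∣L∣≤∣J∣ = J , id , ∪⁺ˡ L , J-indep , ∣L∣≤∣J∣
    go zero       J-indep bound | no ∣L∣≰∣J∣ = ⊥-elim (∣L∣≰∣J∣ bound)
    go (suc fuel) {J} J-indep bound | no ∣L∣≰∣J∣
      with indep-aug M J-indep L-indep (≰⇒> ∣L∣≰∣J∣)
    ... | e , e∈L , e∉J , J+e-indep
      with go fuel J+e-indep (subst (∣ L ∣ ≤_) fuel-step bound)
      where
      fuel-step : suc fuel + ∣ J ∣ ≡ fuel + ∣ J ∪ ⁅ e ⁆ ∣
      fuel-step = trans (sym (+-suc fuel _)) (cong (fuel +_) (sym (x∉p⇒∣p∪⁅x⁆∣≡1+∣p∣ J e e∉J)))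
    ... | J′ , J+e⊆J′ , J′⊆J+e∪L , J′-indep , ∣L∣≤∣J′∣ =
      J′ , J+e⊆J′ ∘ ⁅⁆⁺ˡ e , J′⊆J∪L , J′-indep , ∣L∣≤∣J′∣
      where
      J′⊆J∪L : J′ ⊆ J ∪ L
      J′⊆J∪L w∈J′ with ∪⁻ (J ∪ ⁅ e ⁆) L (J′⊆J+e∪L w∈J′)
      ... | inj₂ w∈L = ∪⁺ʳ J w∈L
      ... | inj₁ w∈J+e with ⁅⁆⁻ J e w∈J+e
      ...   | inj₁ w∈J = ∪⁺ˡ L w∈J
      ...   | inj₂ refl = ∪⁺ʳ J e∈L

  exchange-avoiding : ∀ {I K y} → Ind I → Ind K → K ⊆ I ∪ ⁅ y ⁆ → y ∈ K →
                      Ind (I ∪ ⁅ y ⁆) ⊎ ∃ λ x → x ∈ I × x ∉ K × Ind (I ⟨ x ↦ y ⟩)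
  exchange-avoiding {I} {K} {y} I-indep K-indep K⊆I+y y∈K with indep-extend K-indep I-indep
  ... | J , K⊆J , J⊆K∪I , J-indep , ∣I∣≤∣J∣ with ⊆-or-witness (I ∪ ⁅ y ⁆) J
  ... | inj₁ I+y⊆J = inj₁ (indep-⊆ M I+y⊆J J-indep)
  ... | inj₂ (x , x∈I+y , x∉J) = inj₂ (x , x∈I , x∉J ∘ K⊆J , indep-⊆ M I⟨x↦y⟩⊆J J-indep)
    where
    x∈I : x ∈ I
    x∈I = [ id , (λ { refl → ⊥-elim (x∉J (K⊆J y∈K)) }) ]′ (⁅⁆⁻ I y x∈I+y)
    J⊆I⟨x↦y⟩ : J ⊆ I ⟨ x ↦ y ⟩
    J⊆I⟨x↦y⟩ {w} w∈J with ∪⁻ K I (J⊆K∪I w∈J)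
    ... | inj₂ w∈I = ⁅⁆⁺ˡ y (-⁺ w∈I λ { refl → x∉J w∈J })
    ... | inj₁ w∈K with ⁅⁆⁻ I y (K⊆I+y w∈K)
    ...   | inj₁ w∈I = ⁅⁆⁺ˡ y (-⁺ w∈I λ { refl → x∉J w∈J })
    ...   | inj₂ refl = ⁅⁆⁺ʳ (I - x) w
    I⟨x↦y⟩⊆J : I ⟨ x ↦ y ⟩ ⊆ J
    I⟨x↦y⟩⊆J = p⊆q∧∣q∣≤∣p∣⇒q⊆p J _ J⊆I⟨x↦y⟩
      (≤-trans (∣p∪⁅x⁆∣≤1+∣p∣ (I - x) y) (≤-trans (≤-reflexive (x∈p⇒1+∣p-x∣≡∣p∣ I x x∈I)) ∣I∣≤∣J∣))

  exchange-after-insert : ∀ {I} x y z → ¬ Ind (I ∪ ⁅ y ⁆) → Ind (I ∪ ⁅ z ⁆) → z ∉ I →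
                          x ∈ I → Ind (I ⟨ x ↦ y ⟩) → Ind ((I ∪ ⁅ z ⁆) ⟨ x ↦ y ⟩)
  exchange-after-insert {I} x y z I+y-dep I+z-indep z∉I x∈I L-indep
    with indep-aug M L-indep I+z-indep ∣L∣<∣I+z∣
    where
    ∣L∣<∣I+z∣ : ∣ I ⟨ x ↦ y ⟩ ∣ < ∣ I ∪ ⁅ z ⁆ ∣
    ∣L∣<∣I+z∣ = ≤-trans (s≤s (∣p∪⁅x⁆∣≤1+∣p∣ (I - x) y))
      (≤-reflexive (trans (cong suc (x∈p⇒1+∣p-x∣≡∣p∣ I x x∈I)) (sym (x∉p⇒∣p∪⁅x⁆∣≡1+∣p∣ I z z∉I))))
  ... | e , e∈I+z , e∉L , L+e-indep with ⁅⁆⁻ I z e∈I+z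
  ... | inj₂ refl = indep-⊆ M ⊆L+e L+e-indep
    where
    ⊆L+e : (I ∪ ⁅ e ⁆) ⟨ x ↦ y ⟩ ⊆ I ⟨ x ↦ y ⟩ ∪ ⁅ e ⁆
    ⊆L+e {w} w∈ with ⁅⁆⁻ _ y w∈
    ... | inj₂ refl = ⁅⁆⁺ˡ e (⁅⁆⁺ʳ (I - x) w)
    ... | inj₁ w∈I+e-x with ⁅⁆⁻ I e (-⁻ˡ _ x w∈I+e-x)
    ...   | inj₁ w∈I  = ⁅⁆⁺ˡ e (⁅⁆⁺ˡ y (-⁺ w∈I (-⁻ʳ _ x w∈I+e-x)))
    ...   | inj₂ refl = ⁅⁆⁺ʳ _ w
  ... | inj₁ e∈I = ⊥-elim (I+y-dep (indep-⊆ M ⊆L+e L+e-indep))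
    where
    e≡x : e ≡ x
    e≡x with e ≟ᶠ x
    ... | yes e≡x = e≡x
    ... | no  e≢x = ⊥-elim (e∉L (⁅⁆⁺ˡ y (-⁺ e∈I e≢x)))
    ⊆L+e : I ∪ ⁅ y ⁆ ⊆ I ⟨ x ↦ y ⟩ ∪ ⁅ e ⁆
    ⊆L+e {w} w∈ with ⁅⁆⁻ I y w∈
    ... | inj₂ refl = ⁅⁆⁺ˡ e (⁅⁆⁺ʳ (I - x) w)
    ... | inj₁ w∈I with w ≟ᶠ x
    ...   | yes refl = subst (λ u → w ∈ I ⟨ w ↦ y ⟩ ∪ ⁅ u ⁆) (sym e≡x) (⁅⁆⁺ʳ _ w)
    ...   | no  w≢x  = ⁅⁆⁺ˡ e (⁅⁆⁺ˡ y (-⁺ w∈I w≢x))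

  exchange-after-delete : ∀ {I} x p y → Ind I → x ∈ I → p ∈ I → x ≢ p →
                          ¬ Ind (I ⟨ p ↦ y ⟩) → Ind ((I - p) ⟨ x ↦ y ⟩) → Ind (I ⟨ x ↦ y ⟩)
  exchange-after-delete {I} x p y I-indep x∈I p∈I x≢p I⟨p↦y⟩-dep L-indep
    with indep-aug M L-indep I-indep ∣L∣<∣I∣
    where
    ∣L∣<∣I∣ : ∣ (I - p) ⟨ x ↦ y ⟩ ∣ < ∣ I ∣
    ∣L∣<∣I∣ = ≤-trans (s≤s (∣p∪⁅x⁆∣≤1+∣p∣ ((I - p) - x) y))
      (≤-reflexive (trans (cong suc (x∈p⇒1+∣p-x∣≡∣p∣ (I - p) x (-⁺ x∈I x≢p))) (x∈p⇒1+∣p-x∣≡∣p∣ I p p∈I)))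
  ... | e , e∈I , e∉L , L+e-indep with e ≟ᶠ p
  ... | yes refl = indep-⊆ M ⊆L+e L+e-indep
    where
    ⊆L+e : I ⟨ x ↦ y ⟩ ⊆ (I - e) ⟨ x ↦ y ⟩ ∪ ⁅ e ⁆
    ⊆L+e {w} w∈ with ⁅⁆⁻ _ y w∈
    ... | inj₂ refl = ⁅⁆⁺ˡ e (⁅⁆⁺ʳ _ w)
    ... | inj₁ w∈I-x with w ≟ᶠ e
    ...   | yes refl = ⁅⁆⁺ʳ _ w
    ...   | no  w≢e  = ⁅⁆⁺ˡ e (⁅⁆⁺ˡ y (-⁺ (-⁺ (-⁻ˡ I x w∈I-x) w≢e) (-⁻ʳ I x w∈I-x)))
  ... | no e≢p = ⊥-elim (I⟨p↦y⟩-dep (indep-⊆ M ⊆L+e L+e-indep))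
    where
    e≡x : e ≡ x
    e≡x with e ≟ᶠ x
    ... | yes e≡x = e≡x
    ... | no  e≢x = ⊥-elim (e∉L (⁅⁆⁺ˡ y (-⁺ (-⁺ e∈I e≢p) e≢x)))
    ⊆L+e : I ⟨ p ↦ y ⟩ ⊆ (I - p) ⟨ x ↦ y ⟩ ∪ ⁅ e ⁆
    ⊆L+e {w} w∈ with ⁅⁆⁻ _ y w∈
    ... | inj₂ refl = ⁅⁆⁺ˡ e (⁅⁆⁺ʳ _ w)
    ... | inj₁ w∈I-p with w ≟ᶠ x
    ...   | yes refl = subst (λ u → w ∈ (I - p) ⟨ w ↦ y ⟩ ∪ ⁅ u ⁆) (sym e≡x) (⁅⁆⁺ʳ _ w)
    ...   | no  w≢x  = ⁅⁆⁺ˡ e (⁅⁆⁺ˡ y (-⁺ w∈I-p w≢x))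

-- Ranks and bases of independence systems

Rank-unique : ∀ {Ind : IndepSys n} {X a b} → Rank Ind X a → Rank Ind X b → a ≡ b
Rank-unique ((I , I⊆X , I-indep , refl) , ≤a) ((J , J⊆X , J-indep , refl) , ≤b) =
  ≤-antisym (≤b I I⊆X I-indep) (≤a J J⊆X J-indep)

Rank-mono : ∀ {Ind : IndepSys n} {X Y a b} → X ⊆ Y → Rank Ind X a → Rank Ind Y b → a ≤ b
Rank-mono X⊆Y ((I , I⊆X , I-indep , refl) , _) (_ , ≤b) = ≤b I (X⊆Y ∘ I⊆X) I-indep

Rank-⇔ : ∀ {P Q : IndepSys n} → (∀ {X} → P X ⇔ Q X) → ∀ {X k} → Rank P X k → Rank Q X k
Rank-⇔ P⇔Q ((I , I⊆X , I-indep , ∣I∣≡k) , ≤k) =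
  (I , I⊆X , Equivalence.to P⇔Q I-indep , ∣I∣≡k) , λ J J⊆X J-indep → ≤k J J⊆X (Equivalence.from P⇔Q J-indep)

maximum⇒BasisOf : ∀ {Ind : IndepSys n} {F B} → B ⊆ F → Ind B → (∀ J → J ⊆ F → Ind J → ∣ J ∣ ≤ ∣ B ∣) →
                  BasisOf Ind F B
maximum⇒BasisOf {B = B} B⊆F B-indep maximum =
  B⊆F , B-indep , λ J B⊆J J⊆F J-indep → p⊆q∧∣q∣≤∣p∣⇒q⊆p B J B⊆J (maximum J J⊆F J-indep)

BasisOf-maximal : ∀ {Ind : IndepSys n} {F B} → BasisOf Ind F B → ∀ y → y ∈ F → y ∉ B → ¬ Ind (B ∪ ⁅ y ⁆)
BasisOf-maximal {B = B} (B⊆F , _ , maximal) y y∈F y∉B B+y-indep =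
  y∉B (maximal (B ∪ ⁅ y ⁆) (⁅⁆⁺ˡ y) ([ B⊆F , (λ { refl → y∈F }) ]′ ∘ ⁅⁆⁻ B y) B+y-indep (⁅⁆⁺ʳ B y))

-- Matroid union

module MatroidUnion (Ms : Fin m → Matroid n) where

  open MatroidExchange

  Ind : Fin m → Subset n → Set
  Ind i = Indep (Ms i)

  Indep∨ : Subset n → Set
  Indep∨ = UnionIndep Ind

  Family : Set
  Family = Fin m → Subset n

  IndepFamily : Family → Set
  IndepFamily Is = ∀ i → Ind i (Is i)

  ⋃ᶠ-indep : ∀ {Is} → IndepFamily Is → Indep∨ (⋃ᶠ Is)
  ⋃ᶠ-indep {Is} Is-indep = Is , Is-indep , λ x → mk⇔ (⋃ᶠ⁻ Is) (λ (i , x∈Isᵢ) → ⋃ᶠ⁺ Is i x∈Isᵢ)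

  Indep∨-⊆ : ∀ {I J} → J ⊆ I → Indep∨ I → Indep∨ J
  Indep∨-⊆ {I} {J} J⊆I (Is , Is-indep , cover) =
    (λ i → Is i ∩ J) , (λ i → indep-⊆ (Ms i) (p∩q⊆p _ _) (Is-indep i)) ,
    λ x → mk⇔ (λ x∈J → let i , x∈Isᵢ = Equivalence.to (cover x) (J⊆I x∈J) in i , ∩⁺ x∈Isᵢ x∈J)
              (λ (i , x∈Isᵢ∩J) → p∩q⊆q (Is i) J x∈Isᵢ∩J)

  record Decomposition (I : Subset n) : Set where
    field
      parts    : Family
      indep    : IndepFamily parts
      disjoint : Disjoint parts
      ⋃parts   : ⋃ᶠ parts ≡ I

  decompose : ∀ {I} → Indep∨ I → Decomposition I
  decompose {I} (Is , Is-indep , cover) = record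
    { parts    = disjointify Is
    ; indep    = λ i → indep-⊆ (Ms i) (disjointify-⊆ Is i) (Is-indep i)
    ; disjoint = disjointify-disjoint Is
    ; ⋃parts   = ⊆-antisym ⋃⊆I I⊆⋃
    }
    where
    ⋃⊆I : ⋃ᶠ (disjointify Is) ⊆ I
    ⋃⊆I x∈⋃ = let i , x∈Dᵢ = ⋃ᶠ⁻ _ x∈⋃ in Equivalence.from (cover _) (i , disjointify-⊆ Is i x∈Dᵢ)
    I⊆⋃ : I ⊆ ⋃ᶠ (disjointify Is)
    I⊆⋃ x∈I = let i , x∈Isᵢ = Equivalence.to (cover _) x∈I
                  j , x∈Dⱼ  = disjointify-covers Is i x∈Isᵢ
              in ⋃ᶠ⁺ _ j x∈Dⱼ

  -- The exchange graph: Arc Is i y x is an arc y → x (y may replace x in Is i), and Sink Is i y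
  -- says that y may be added to Is i.
  Arc : Family → Fin m → Fin n → Fin n → Set
  Arc Is i y x = x ∈ Is i × y ∉ Is i × Ind i (Is i ⟨ x ↦ y ⟩)

  Sink : Family → Fin m → Fin n → Set
  Sink Is i y = y ∉ Is i × Ind i (Is i ∪ ⁅ y ⁆)

  -- Without an earlier sink or a shortcut, the path stays valid after its last exchange is
  -- performed (ShortenPath), so it can be augmented one arc at a time.
  record ShortestPath (Is : Family) (q : ℕ) (y : ℕ → Fin n) (s : Fin m) : Set where
    field
      source-uncovered : ∀ i → y 0 ∉ Is i
      arc              : ∀ l → l < q → ∃ λ i → Arc Is i (y l) (y (suc l))
      target-sink      : Sink Is s (y q)
      no-earlier-sink  : ∀ l → l < q → ∀ i → ¬ Sink Is i (y l)
      no-shortcut      : ∀ l k → suc l < k → k ≤ q → ∀ i → ¬ Arc Is i (y l) (y k)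

  module ShortenPath {Is p y s} (Is-indep : IndepFamily Is) (path : ShortestPath Is (suc p) y s)
                     {a} (last-arc : Arc Is a (y p) (y (suc p))) where

    open ShortestPath path

    private
      z : Fin n
      z = y (suc p)

      z∈Isₐ : z ∈ Is a
      z∈Isₐ = proj₁ last-arc

      a≢s : a ≢ s
      a≢s refl = proj₁ target-sink z∈Isₐ

      distinct : ∀ l → l ≤ p → y l ≢ z
      distinct zero    _   y₀≡z = source-uncovered a (subst (_∈ Is a) (sym y₀≡z) z∈Isₐ)
      distinct (suc l) l<p yₗ≡z with arc l (m≤n⇒m≤1+n l<p)
      ... | i , yₗ→yₗ₊₁ = no-shortcut l (suc p) (s≤s l<p) ≤-refl i (subst (Arc Is i (y l)) yₗ≡z yₗ→yₗ₊₁)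

    shifted : Family
    shifted = updateAt (updateAt Is a (_- z)) s (_∪ ⁅ z ⁆)

    shifted-elim : (P : Fin m → Subset n → Set) → P s (Is s ∪ ⁅ z ⁆) → P a (Is a - z) →
                   (∀ j → j ≢ s → j ≢ a → P j (Is j)) → ∀ j → P j (shifted j)
    shifted-elim P Pₛ Pₐ Pⱼ = updateAt-elim P _ s
      (subst (λ S → P s (S ∪ ⁅ z ⁆)) (sym (updateAt-minimal s a Is (a≢s ∘ sym))) Pₛ)
      (λ j j≢s → updateAt-elim (λ j S → j ≢ s → P j S) Is a (λ _ → Pₐ) (λ j j≢a j≢s → Pⱼ j j≢s j≢a) j j≢s)

    shifted-indep : IndepFamily shifted
    shifted-indep = shifted-elim Ind (proj₂ target-sink)
      (indep-⊆ (Ms a) (-⁻ˡ (Is a) z) (Is-indep a)) (λ j _ _ → Is-indep j)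

    ⋃ᶠ⊆⋃ᶠshifted : ⋃ᶠ Is ⊆ ⋃ᶠ shifted
    ⋃ᶠ⊆⋃ᶠshifted {x} x∈⋃ with ⋃ᶠ⁻ Is x∈⋃ | x ≟ᶠ z
    ... | _ , _ | yes refl =
      ⋃ᶠ⁺ shifted s (shifted-elim (λ j S → j ≡ s → z ∈ S) (λ _ → ⁅⁆⁺ʳ (Is s) z)
                       (λ a≡s → ⊥-elim (a≢s a≡s)) (λ j j≢s _ j≡s → ⊥-elim (j≢s j≡s)) s refl)
    ... | i , x∈Isᵢ | no x≢z =
      ⋃ᶠ⁺ shifted i (shifted-elim (λ j S → x ∈ Is j → x ∈ S) (⁅⁆⁺ˡ z) (λ x∈ → -⁺ x∈ x≢z)
                       (λ _ _ _ → id) i x∈Isᵢ)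

    shifted-path : ShortestPath shifted p y a
    shifted-path = record
      { source-uncovered = λ i → shifted-elim (λ j S → y 0 ∉ S)
          (λ y₀∈ → [ source-uncovered s , distinct 0 z≤n ]′ (⁅⁆⁻ (Is s) z y₀∈))
          (λ y₀∈ → source-uncovered a (-⁻ˡ (Is a) z y₀∈)) (λ j _ _ → source-uncovered j) i
      ; arc = arc′
      ; target-sink = shifted-elim (λ j S → j ≡ a → y p ∉ S × Ind j (S ∪ ⁅ y p ⁆))
          (λ s≡a → ⊥-elim (a≢s (sym s≡a)))
          (λ _ → (λ yₚ∈ → proj₁ (proj₂ last-arc) (-⁻ˡ (Is a) z yₚ∈)) , proj₂ (proj₂ last-arc))
          (λ j _ j≢a j≡a → ⊥-elim (j≢a j≡a)) a refl
      ; no-earlier-sink = no-earlier-sink′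
      ; no-shortcut = no-shortcut′
      }
      where
      arc′ : ∀ l → l < p → ∃ λ i → Arc shifted i (y l) (y (suc l))
      arc′ l l<p with arc l (m≤n⇒m≤1+n l<p)
      ... | i , yₗ→yₗ₊₁ =
        i , shifted-elim (λ j S → Arc Is j (y l) (y (suc l)) → Arc′ S j) onₛ onₐ (λ _ _ _ → id) i yₗ→yₗ₊₁
        where
        Arc′ : Subset n → Fin m → Set
        Arc′ S j = y (suc l) ∈ S × y l ∉ S × Ind j (S ⟨ y (suc l) ↦ y l ⟩)
        onₛ : Arc Is s (y l) (y (suc l)) → Arc′ (Is s ∪ ⁅ z ⁆) s
        onₛ (yₗ₊₁∈ , yₗ∉ , exchange) =
          ⁅⁆⁺ˡ z yₗ₊₁∈ , [ yₗ∉ , distinct l (<⇒≤ l<p) ]′ ∘ ⁅⁆⁻ (Is s) z ,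
          exchange-after-insert (Ms s) (y (suc l)) (y l) z
            (λ ind → no-earlier-sink l (m≤n⇒m≤1+n l<p) s (yₗ∉ , ind)) (proj₂ target-sink) (proj₁ target-sink)
            yₗ₊₁∈ exchange
        onₐ : Arc Is a (y l) (y (suc l)) → Arc′ (Is a - z) a
        onₐ (yₗ₊₁∈ , yₗ∉ , exchange) =
          -⁺ yₗ₊₁∈ (distinct (suc l) l<p) , yₗ∉ ∘ -⁻ˡ (Is a) z ,
          indep-⊆ (Ms a) (⟨↦⟩-mono (y (suc l)) (y l) (-⁻ˡ (Is a) z)) exchange

      no-earlier-sink′ : ∀ l → l < p → ∀ i → ¬ Sink shifted i (y l)
      no-earlier-sink′ l l<p = shifted-elim (λ j S → ¬ (y l ∉ S × Ind j (S ∪ ⁅ y l ⁆)))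
        (λ (yₗ∉ , ind) → no-earlier-sink l (m≤n⇒m≤1+n l<p) s
           (yₗ∉ ∘ ⁅⁆⁺ˡ z , indep-⊆ (Ms s) (∪⁅⁆-mono (y l) (⁅⁆⁺ˡ z)) ind))
        (λ (yₗ∉ , ind) → no-shortcut l (suc p) (s≤s l<p) ≤-refl a
           (z∈Isₐ , (λ yₗ∈ → yₗ∉ (-⁺ yₗ∈ (distinct l (<⇒≤ l<p)))) , ind))
        (λ j _ _ → no-earlier-sink l (m≤n⇒m≤1+n l<p) j)

      no-shortcut′ : ∀ l k → suc l < k → k ≤ p → ∀ i → ¬ Arc shifted i (y l) (y k)
      no-shortcut′ l k l+1<k k≤p = shifted-elim (λ j S → ¬ (y k ∈ S × y l ∉ S × Ind j (S ⟨ y k ↦ y l ⟩)))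
        (λ (yₖ∈ , yₗ∉ , ind) → [ (λ yₖ∈Isₛ → old s (yₖ∈Isₛ , yₗ∉ ∘ ⁅⁆⁺ˡ z ,
                                     indep-⊆ (Ms s) (⟨↦⟩-mono (y k) (y l) (⁅⁆⁺ˡ z)) ind))
                               , distinct k k≤p ]′ (⁅⁆⁻ (Is s) z yₖ∈))
        (λ (yₖ∈ , yₗ∉ , ind) →
          let yₖ∈Isₐ = -⁻ˡ (Is a) z yₖ∈
              yₗ∉Isₐ = λ yₗ∈ → yₗ∉ (-⁺ yₗ∈ (distinct l (<⇒≤ l<p)))
          in old a (yₖ∈Isₐ , yₗ∉Isₐ ,
               exchange-after-delete (Ms a) (y k) z (y l) (Is-indep a) yₖ∈Isₐ z∈Isₐ (distinct k k≤p)
                 (λ ind′ → no-shortcut l (suc p) (s≤s l<p) ≤-refl a (z∈Isₐ , yₗ∉Isₐ , ind′)) ind))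
        (λ j _ _ → old j)
        where
        old : ∀ i → ¬ Arc Is i (y l) (y k)
        old = no-shortcut l k l+1<k (m≤n⇒m≤1+n k≤p)
        l<p : l < p
        l<p = <-≤-trans (n<1+n l) (≤-trans (<⇒≤ l+1<k) k≤p)

  augment : ∀ q {Is y s} → IndepFamily Is → ShortestPath Is q y s → Indep∨ (⋃ᶠ Is ∪ ⁅ y 0 ⁆)
  augment zero {Is} {y} {s} Is-indep path =
    Indep∨-⊆ ⊆⋃grown (⋃ᶠ-indep (updateAt-elim Ind Is s (proj₂ target-sink) (λ j _ → Is-indep j)))
    where
    open ShortestPath path
    grown : Family
    grown = updateAt Is s (_∪ ⁅ y 0 ⁆)
    ⊆⋃grown : ⋃ᶠ Is ∪ ⁅ y 0 ⁆ ⊆ ⋃ᶠ grown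
    ⊆⋃grown x∈ with ⁅⁆⁻ (⋃ᶠ Is) (y 0) x∈
    ... | inj₁ x∈⋃ = let i , x∈Isᵢ = ⋃ᶠ⁻ Is x∈⋃ in
      ⋃ᶠ⁺ grown i (updateAt-elim (λ j S → _ ∈ Is j → _ ∈ S) Is s (⁅⁆⁺ˡ (y 0)) (λ _ _ → id) i x∈Isᵢ)
    ... | inj₂ refl =
      ⋃ᶠ⁺ grown s (updateAt-elim (λ j S → j ≡ s → y 0 ∈ S) Is s (λ _ → ⁅⁆⁺ʳ (Is s) (y 0))
                     (λ j j≢s j≡s → ⊥-elim (j≢s j≡s)) s refl)
  augment (suc p) {Is} Is-indep path with ShortestPath.arc path p ≤-refl
  ... | a , last-arc = Indep∨-⊆ (∪⁅⁆-mono _ ⋃ᶠ⊆⋃ᶠshifted) (augment p shifted-indep shifted-path)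
    where open ShortenPath Is-indep path last-arc

  arc-closed-bound : ∀ {Is} → IndepFamily Is → ∀ {R} →
                     (∀ {i y x} → y ∈ R → Arc Is i y x → x ∈ R) → (∀ {i y} → y ∈ R → ¬ Sink Is i y) →
                     ∀ i {J} → J ⊆ R → Ind i J → ∣ J ∣ ≤ ∣ Is i ∩ R ∣
  arc-closed-bound {Is} Is-indep {R} closed sinkless i {J} J⊆R J-indep with ∣ J ∣ ≤? ∣ Is i ∩ R ∣
  ... | yes ∣J∣≤ = ∣J∣≤
  ... | no  ∣J∣≰
    with indep-aug (Ms i) (indep-⊆ (Ms i) (p∩q⊆p (Is i) R) (Is-indep i)) J-indep (≰⇒> ∣J∣≰)
  ... | y , y∈J , y∉Isᵢ∩R , K-indep = ⊥-elim ([ sink , arc-leaving-R ]′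
          (exchange-avoiding (Ms i) (Is-indep i) K-indep (∪⁅⁆-mono y (p∩q⊆p (Is i) R)) (⁅⁆⁺ʳ _ y)))
    where
    y∈R : y ∈ R
    y∈R = J⊆R y∈J
    y∉Isᵢ : y ∉ Is i
    y∉Isᵢ y∈Isᵢ = y∉Isᵢ∩R (∩⁺ y∈Isᵢ y∈R)
    sink : ¬ Ind i (Is i ∪ ⁅ y ⁆)
    sink Isᵢ+y-indep = sinkless y∈R (y∉Isᵢ , Isᵢ+y-indep)
    arc-leaving-R : ¬ (∃ λ x → x ∈ Is i × x ∉ (Is i ∩ R) ∪ ⁅ y ⁆ × Ind i (Is i ⟨ x ↦ y ⟩))
    arc-leaving-R (x , x∈Isᵢ , x∉K , exchange) =
      x∉K (⁅⁆⁺ˡ y (∩⁺ x∈Isᵢ (closed y∈R (x∈Isᵢ , y∉Isᵢ , exchange))))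

  -- R is the minimiser in Edmonds' formula r(X) = min over R of |X ─ R| + Σᵢ rᵢ(R).
  record Certificate (X : Subset n) (Is : Family) : Set where
    field
      R      : Subset n
      covers : ∀ {x} → x ∈ X → x ∉ R → x ∈ ⋃ᶠ Is
      bound  : ∀ i {J} → J ⊆ R → Ind i J → ∣ J ∣ ≤ ∣ Is i ∩ R ∣

  -- Breadth-first search from the uncovered elements of X: the first sink found ends a shortest
  -- augmenting path; if there is none, the stable reachable set is the R of a certificate.
  module Search (X : Subset n) {Is : Family} (Is-indep : IndepFamily Is) where

    Arc? : ∀ i y x → Dec (Arc Is i y x)
    Arc? i y x = (x ∈? Is i) ×-dec ¬? (y ∈? Is i) ×-dec indep? (Ms i) _

    Sink? : ∀ i y → Dec (Sink Is i y)
    Sink? i y = ¬? (y ∈? Is i) ×-dec indep? (Ms i) _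

    Uncovered? : ∀ x → Dec (x ∈ X × x ∉ ⋃ᶠ Is)
    Uncovered? x = (x ∈? X) ×-dec ¬? (x ∈? ⋃ᶠ Is)

    Reach : ℕ → Subset n
    Reach-step? : ∀ l x → Dec (x ∈ Reach l ⊎ ∃ λ y → y ∈ Reach l × ∃ λ i → Arc Is i y x)

    Reach zero    = subset Uncovered?
    Reach (suc l) = subset (Reach-step? l)

    Reach-step? l x = (x ∈? Reach l) ⊎-dec any? (λ y → (y ∈? Reach l) ×-dec any? (λ i → Arc? i y x))

    Reach-zero⁺ : ∀ {x} → x ∈ X → x ∉ ⋃ᶠ Is → x ∈ Reach 0
    Reach-zero⁺ x∈X x∉⋃ = subset⁺ Uncovered? (x∈X , x∉⋃)

    Reach-zero⁻ : ∀ {x} → x ∈ Reach 0 → x ∈ X × x ∉ ⋃ᶠ Is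
    Reach-zero⁻ = subset⁻ Uncovered?

    Reach-suc⁺ : ∀ l {x} → x ∈ Reach l ⊎ (∃ λ y → y ∈ Reach l × ∃ λ i → Arc Is i y x) → x ∈ Reach (suc l)
    Reach-suc⁺ l = subset⁺ (Reach-step? l)

    Reach-suc⁻ : ∀ l {x} → x ∈ Reach (suc l) → x ∈ Reach l ⊎ (∃ λ y → y ∈ Reach l × ∃ λ i → Arc Is i y x)
    Reach-suc⁻ l = subset⁻ (Reach-step? l)

    Reach-arc : ∀ l {i y x} → y ∈ Reach l → Arc Is i y x → x ∈ Reach (suc l)
    Reach-arc l y∈ y→x = Reach-suc⁺ l (inj₂ (_ , y∈ , _ , y→x))

    Reach-mono : ∀ {l l′} → l ≤ l′ → Reach l ⊆ Reach l′
    Reach-mono {l′ = zero}   z≤n = id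
    Reach-mono {l′ = suc l′} l≤l′+1 with m≤n⇒m<n∨m≡n l≤l′+1
    ... | inj₂ refl        = id
    ... | inj₁ (s≤s l≤l′) = Reach-suc⁺ l′ ∘ inj₁ ∘ Reach-mono l≤l′

    Reach-stabilises : ∃ λ l → Reach (suc l) ⊆ Reach l
    Reach-stabilises with grows (suc n)
      where
      grows : ∀ l → (∃ λ l → Reach (suc l) ⊆ Reach l) ⊎ l ≤ ∣ Reach l ∣
      grows zero = inj₂ z≤n
      grows (suc l) with grows l
      ... | inj₁ stable = inj₁ stable
      ... | inj₂ l≤∣Reachₗ∣ with ⊆-or-witness (Reach (suc l)) (Reach l)
      ...   | inj₁ stable = inj₁ (l , stable)
      ...   | inj₂ new    = inj₂ (<-≤-trans (s≤s l≤∣Reachₗ∣) (p⊂q⇒∣p∣<∣q∣ (Reach-suc⁺ l ∘ inj₁ , new)))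
    ... | inj₁ stable = stable
    ... | inj₂ n+1≤∣Reach∣ = ⊥-elim (<-irrefl refl (≤-trans n+1≤∣Reach∣ (∣p∣≤n (Reach (suc n)))))

    NewAt : ℕ → Fin n → Set
    NewAt zero    x = x ∈ Reach 0
    NewAt (suc l) x = x ∈ Reach (suc l) × x ∉ Reach l

    NewAt⇒∈ : ∀ l {x} → NewAt l x → x ∈ Reach l
    NewAt⇒∈ zero    = id
    NewAt⇒∈ (suc l) = proj₁

    NewAt-pred : ∀ l {i y x} → y ∈ Reach l → Arc Is i y x → NewAt (suc l) x → NewAt l y
    NewAt-pred zero    y∈ _   _         = y∈
    NewAt-pred (suc l) y∈ y→x (_ , x∉) = y∈ , λ y∈Reachₗ → x∉ (Reach-arc l y∈Reachₗ y→x)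

    NewAt-no-shortcut : ∀ l k {i y x} → suc l < k → y ∈ Reach l → NewAt k x → ¬ Arc Is i y x
    NewAt-no-shortcut l (suc k) (s≤s l<k) y∈ (_ , x∉) y→x = x∉ (Reach-mono l<k (Reach-arc l y∈ y→x))

    record Walk (l : ℕ) (x : Fin n) : Set where
      field
        vertex : ℕ → Fin n
        ends   : vertex l ≡ x
        new    : ∀ j → j ≤ l → NewAt j (vertex j)
        arcs   : ∀ j → j < l → ∃ λ i → Arc Is i (vertex j) (vertex (suc j))

    snoc : (ℕ → Fin n) → ℕ → Fin n → ℕ → Fin n
    snoc y l x j with j ≤? l
    ... | yes _ = y j
    ... | no  _ = x

    snoc-≤ : ∀ y x {l j} → j ≤ l → snoc y l x j ≡ y j
    snoc-≤ y x {l} {j} j≤l with j ≤? l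
    ... | yes _   = refl
    ... | no  j≰l = ⊥-elim (j≰l j≤l)

    snoc-suc : ∀ y l x → snoc y l x (suc l) ≡ x
    snoc-suc y l x with suc l ≤? l
    ... | yes l+1≤l = ⊥-elim (<-irrefl refl l+1≤l)
    ... | no  _     = refl

    walk-to : ∀ l {x} → NewAt l x → Walk l x
    walk-to zero {x} x∈ = record { vertex = λ _ → x ; ends = refl ; new = λ { zero _ → x∈ } ; arcs = λ _ () }
    walk-to (suc l) {x} (x∈ , x∉) with Reach-suc⁻ l x∈
    ... | inj₁ x∈Reachₗ = ⊥-elim (x∉ x∈Reachₗ)
    ... | inj₂ (y′ , y′∈ , i , y′→x) =
      record { vertex = snoc w.vertex l x ; ends = snoc-suc w.vertex l x ; new = new ; arcs = arcs }
      where
      module w = Walk (walk-to l (NewAt-pred l y′∈ y′→x (x∈ , x∉)))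
      new : ∀ j → j ≤ suc l → NewAt j (snoc w.vertex l x j)
      new j j≤l+1 with m≤n⇒m<n∨m≡n j≤l+1
      ... | inj₂ refl       = subst (NewAt j) (sym (snoc-suc w.vertex l x)) (x∈ , x∉)
      ... | inj₁ (s≤s j≤l) = subst (NewAt j) (sym (snoc-≤ w.vertex x j≤l)) (w.new j j≤l)
      arcs : ∀ j → j < suc l → ∃ λ i → Arc Is i (snoc w.vertex l x j) (snoc w.vertex l x (suc j))
      arcs j (s≤s j≤l) with m≤n⇒m<n∨m≡n j≤l
      ... | inj₂ refl =
        i , subst₂ (Arc Is i) (sym (trans (snoc-≤ w.vertex x ≤-refl) w.ends)) (sym (snoc-suc w.vertex l x)) y′→x
      ... | inj₁ j<l  = let i′ , yⱼ→yⱼ₊₁ = w.arcs j j<l in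
        i′ , subst₂ (Arc Is i′) (sym (snoc-≤ w.vertex x (<⇒≤ j<l))) (sym (snoc-≤ w.vertex x j<l)) yⱼ→yⱼ₊₁

    HasSink : ℕ → Set
    HasSink l = ∃ λ x → x ∈ Reach l × ∃ λ i → Sink Is i x

    NoSinkBefore : ℕ → Set
    NoSinkBefore zero    = ⊤
    NoSinkBefore (suc q) = ¬ HasSink q

    HasSink? : ∀ l → Dec (HasSink l)
    HasSink? l = any? (λ x → (x ∈? Reach l) ×-dec any? (λ i → Sink? i x))

    first-sink : ∀ l → (∃ λ q → HasSink q × NoSinkBefore q) ⊎ ¬ HasSink l
    first-sink zero with HasSink? zero
    ... | yes sink  = inj₁ (0 , sink , tt)
    ... | no  ¬sink = inj₂ ¬sink
    first-sink (suc l) with first-sink l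
    ... | inj₁ first = inj₁ first
    ... | inj₂ ¬sinkₗ with HasSink? (suc l)
    ...   | yes sink  = inj₁ (suc l , sink , ¬sinkₗ)
    ...   | no  ¬sink = inj₂ ¬sink

    sink-NewAt : ∀ q {x i} → x ∈ Reach q → Sink Is i x → NoSinkBefore q → NewAt q x
    sink-NewAt zero    x∈ _    _      = x∈
    sink-NewAt (suc q) x∈ sink ¬sinkₚ = x∈ , λ x∈Reachₚ → ¬sinkₚ (_ , x∈Reachₚ , _ , sink)

    NoSinkBefore-sinkless : ∀ q → NoSinkBefore q → ∀ {l x i} → l < q → x ∈ Reach l → ¬ Sink Is i x
    NoSinkBefore-sinkless (suc q) ¬sinkₚ (s≤s l≤q) x∈ sink = ¬sinkₚ (_ , Reach-mono l≤q x∈ , _ , sink)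

    shortest-path : ∀ q {x s} (w : Walk q x) → Sink Is s x → NoSinkBefore q →
                    ShortestPath Is q (Walk.vertex w) s
    shortest-path q w sink ¬sink-before = record
      { source-uncovered = λ i y₀∈Isᵢ → proj₂ (Reach-zero⁻ (new 0 z≤n)) (⋃ᶠ⁺ Is i y₀∈Isᵢ)
      ; arc              = arcs
      ; target-sink      = subst (Sink Is _) (sym ends) sink
      ; no-earlier-sink  = λ l l<q i →
                             NoSinkBefore-sinkless q ¬sink-before l<q (NewAt⇒∈ l (new l (<⇒≤ l<q)))
      ; no-shortcut      = λ l k l+1<k k≤q i → NewAt-no-shortcut l k l+1<k
                             (NewAt⇒∈ l (new l (≤-trans (<⇒≤ (<-trans (n<1+n l) l+1<k)) k≤q))) (new k k≤q)
      }
      where open Walk w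

    augment-or-certify : (∃ λ y → (y ∈ X × y ∉ ⋃ᶠ Is) × Indep∨ (⋃ᶠ Is ∪ ⁅ y ⁆)) ⊎ Certificate X Is
    augment-or-certify with Reach-stabilises
    ... | l , stable with first-sink l
    ... | inj₁ (q , (x , x∈ , s , sink) , ¬sink-before) =
      inj₁ (vertex 0 , Reach-zero⁻ (new 0 z≤n) , augment q Is-indep (shortest-path q w sink ¬sink-before))
      where
      w : Walk q x
      w = walk-to q (sink-NewAt q x∈ sink ¬sink-before)
      open Walk w
    ... | inj₂ ¬sink = inj₂ record
      { R      = Reach l
      ; covers = covers
      ; bound  = arc-closed-bound Is-indep {Reach l} (λ y∈ y→x → stable (Reach-arc l y∈ y→x))
                                           (λ y∈ sink → ¬sink (_ , y∈ , _ , sink))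
      }
      where
      covers : ∀ {x} → x ∈ X → x ∉ Reach l → x ∈ ⋃ᶠ Is
      covers {x} x∈X x∉ with x ∈? ⋃ᶠ Is
      ... | yes x∈⋃ = x∈⋃
      ... | no  x∉⋃ = ⊥-elim (x∉ (Reach-mono {l′ = l} z≤n (Reach-zero⁺ x∈X x∉⋃)))

  certificate⇒maximum : ∀ {X Is} → Disjoint Is → Certificate X Is → ∀ {K} → K ⊆ X → Indep∨ K → ∣ K ∣ ≤ ∣ ⋃ᶠ Is ∣
  certificate⇒maximum {X} {Is} disjoint cert {K} K⊆X (Ks , Ks-indep , cover) = begin
    ∣ K ∣                           ≡⟨ ∣p∣≡∣p∩q∣+∣p─q∣ K R ⟩
    ∣ K ∩ R ∣ + ∣ K ─ R ∣           ≤⟨ +-mono-≤ inside outside ⟩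
    ∣ ⋃ᶠ Is ∩ R ∣ + ∣ ⋃ᶠ Is ─ R ∣   ≡⟨ ∣p∣≡∣p∩q∣+∣p─q∣ (⋃ᶠ Is) R ⟨
    ∣ ⋃ᶠ Is ∣                       ∎
    where
    open ≤-Reasoning
    open Certificate cert
    K∩R⊆ : K ∩ R ⊆ ⋃ᶠ (λ i → Ks i ∩ R)
    K∩R⊆ x∈ = let x∈K , x∈R = x∈p∩q⁻ K R x∈
                  i , x∈Ksᵢ = Equivalence.to (cover _) x∈K
              in ⋃ᶠ⁺ _ i (∩⁺ x∈Ksᵢ x∈R)
    inside : ∣ K ∩ R ∣ ≤ ∣ ⋃ᶠ Is ∩ R ∣
    inside = begin
      ∣ K ∩ R ∣                 ≤⟨ p⊆q⇒∣p∣≤∣q∣ K∩R⊆ ⟩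
      ∣ ⋃ᶠ (λ i → Ks i ∩ R) ∣   ≤⟨ ∣⋃ᶠ∣≤∑ (λ i → Ks i ∩ R) ⟩
      ∑[ i < m ] ∣ Ks i ∩ R ∣   ≤⟨ ∑-mono-≤ (λ i → bound i (p∩q⊆q _ R) (indep-⊆ (Ms i) (p∩q⊆p _ R) (Ks-indep i)))
                                 ⟩
      ∑[ i < m ] ∣ Is i ∩ R ∣   ≡⟨ Disjoint⇒∑∣∩∣≡∣⋃ᶠ∩∣ Is R disjoint ⟩
      ∣ ⋃ᶠ Is ∩ R ∣             ∎
    outside : ∣ K ─ R ∣ ≤ ∣ ⋃ᶠ Is ─ R ∣
    outside = p⊆q⇒∣p∣≤∣q∣ λ x∈ → ─⁺ (covers (K⊆X (─⁻ˡ K R x∈)) (─⁻ʳ K R x∈)) (─⁻ʳ K R x∈)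

  record Optimal (X : Subset n) : Set where
    field
      parts       : Family
      indep       : IndepFamily parts
      disjoint    : Disjoint parts
      parts⊆X     : ∀ i → parts i ⊆ X
      certificate : Certificate X parts

  Indep∨-∅ : Indep∨ ⊥
  Indep∨-∅ = (λ _ → ⊥) , (λ i → indep-∅ (Ms i)) , λ x → mk⇔ (⊥-elim ∘ ∉⊥) (⊥-elim ∘ ∉⊥ ∘ proj₂)

  optimal : ∀ X → Optimal X
  optimal X = grow ∣ X ∣ (⊥-elim ∘ ∉⊥) Indep∨-∅ (m≤m+n ∣ X ∣ ∣ ⊥ {n} ∣)
    where
    grow : ∀ fuel {I} → I ⊆ X → Indep∨ I → ∣ X ∣ ≤ fuel + ∣ I ∣ → Optimal X
    grow fuel I⊆X I-indep ∣X∣≤ with decompose I-indep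
    ... | record { parts = Is ; indep = Is-indep ; disjoint = disjoint ; ⋃parts = refl }
      with Search.augment-or-certify X Is-indep
    ... | inj₂ cert = record
      { parts = Is ; indep = Is-indep ; disjoint = disjoint
      ; parts⊆X = λ i → I⊆X ∘ ⋃ᶠ⁺ Is i ; certificate = cert }
    ... | inj₁ (y , (y∈X , y∉⋃) , I+y-indep) = continue fuel ∣X∣≤
      where
      I+y⊆X : ⋃ᶠ Is ∪ ⁅ y ⁆ ⊆ X
      I+y⊆X = [ I⊆X , (λ { refl → y∈X }) ]′ ∘ ⁅⁆⁻ _ y
      ∣I+y∣ : ∣ ⋃ᶠ Is ∪ ⁅ y ⁆ ∣ ≡ suc ∣ ⋃ᶠ Is ∣
      ∣I+y∣ = x∉p⇒∣p∪⁅x⁆∣≡1+∣p∣ (⋃ᶠ Is) y y∉⋃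
      continue : ∀ fuel → ∣ X ∣ ≤ fuel + ∣ ⋃ᶠ Is ∣ → Optimal X
      continue zero       ∣X∣≤ = ⊥-elim (<⇒≱ (<-≤-trans (≤-reflexive (sym ∣I+y∣)) (p⊆q⇒∣p∣≤∣q∣ I+y⊆X)) ∣X∣≤)
      continue (suc fuel) ∣X∣≤ =
        grow fuel I+y⊆X I+y-indep
             (subst (∣ X ∣ ≤_) (trans (sym (+-suc fuel _)) (cong (fuel +_) (sym ∣I+y∣))) ∣X∣≤)

  maximal⇒maximum : ∀ {X I} → I ⊆ X → Indep∨ I → (∀ y → y ∈ X → y ∉ I → ¬ Indep∨ (I ∪ ⁅ y ⁆)) →
                    ∀ {K} → K ⊆ X → Indep∨ K → ∣ K ∣ ≤ ∣ I ∣
  maximal⇒maximum {X} I⊆X I-indep maximal with decompose I-indep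
  ... | record { parts = Is ; indep = Is-indep ; disjoint = disjoint ; ⋃parts = refl }
    with Search.augment-or-certify X Is-indep
  ... | inj₁ (y , (y∈X , y∉⋃) , I+y-indep) = ⊥-elim (maximal y y∈X y∉⋃ I+y-indep)
  ... | inj₂ cert = certificate⇒maximum disjoint cert

  maximal⇒Rank : ∀ {X I} → I ⊆ X → Indep∨ I → (∀ y → y ∈ X → y ∉ I → ¬ Indep∨ (I ∪ ⁅ y ⁆)) →
                 Rank Indep∨ X ∣ I ∣
  maximal⇒Rank I⊆X I-indep maximal =
    (_ , I⊆X , I-indep , refl) , λ K K⊆X → maximal⇒maximum I⊆X I-indep maximal K⊆X

  BasisOf⇒Rank : ∀ {F B} → BasisOf Indep∨ F B → Rank Indep∨ F ∣ B ∣
  BasisOf⇒Rank basis@(B⊆F , B-indep , _) = maximal⇒Rank B⊆F B-indep (BasisOf-maximal basis)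

  basis : Subset n → Subset n
  basis X = ⋃ᶠ (Optimal.parts (optimal X))

  basis⊆ : ∀ X → basis X ⊆ X
  basis⊆ X x∈ = let i , x∈partᵢ = ⋃ᶠ⁻ parts x∈ in parts⊆X i x∈partᵢ
    where open Optimal (optimal X)

  basis-indep : ∀ X → Indep∨ (basis X)
  basis-indep X = ⋃ᶠ-indep (Optimal.indep (optimal X))

  rank : Subset n → ℕ
  rank X = ∣ basis X ∣

  Rank-rank : ∀ X → Rank Indep∨ X (rank X)
  Rank-rank X =
    (basis X , basis⊆ X , basis-indep X , refl) , λ K K⊆X → certificate⇒maximum disjoint certificate K⊆X
    where open Optimal (optimal X)

-- Expansions

UnionIndep-reindex : ∀ {ι κ : Set} (e : κ ↔ ι) (N : ι → IndepSys n) {X} →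
                     UnionIndep N X ⇔ UnionIndep (N ∘ Inverse.to e) X
UnionIndep-reindex e N {X} = mk⇔
  (λ (Is , Is-indep , cover) →
    (Is ∘ to) , (Is-indep ∘ to) , λ x → mk⇔
      (λ x∈X → let i , x∈Isᵢ = Equivalence.to (cover x) x∈X in
               from i , subst (λ i → x ∈ Is i) (sym (strictlyInverseˡ i)) x∈Isᵢ)
      (λ (j , x∈Isⱼ) → Equivalence.from (cover x) (to j , x∈Isⱼ)))
  (λ (Js , Js-indep , cover) →
    (Js ∘ from) , (λ i → subst (λ i′ → N i′ (Js (from i))) (strictlyInverseˡ i) (Js-indep (from i))) , λ x → mk⇔
      (λ x∈X → let j , x∈Jsⱼ = Equivalence.to (cover x) x∈X in
               to j , subst (λ j → x ∈ Js j) (sym (strictlyInverseʳ j)) x∈Jsⱼ)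
      (λ (i , x∈Jsᵢ) → Equivalence.from (cover x) (from i , x∈Jsᵢ)))
  where open Inverse e

∣tabulate∣-+ : ∀ t {k} (g : Fin (t + k) → _) →
               ∣ tabulate g ∣ ≡ ∣ tabulate {t} (g ∘ (_↑ˡ k)) ∣ + ∣ tabulate {k} (g ∘ (t ↑ʳ_)) ∣
∣tabulate∣-+ zero    g = refl
∣tabulate∣-+ (suc t) g with g zero
... | true  = cong suc (∣tabulate∣-+ t (g ∘ suc))
... | false = ∣tabulate∣-+ t (g ∘ suc)

∣tabulate-const∣ : ∀ t b (p : Subset n) → ∣ tabulate {t} (λ _ → b) ∣ + t * ∣ p ∣ ≡ t * ∣ b ∷ p ∣
∣tabulate-const∣ t b p = trans (cong (λ q → ∣ q ∣ + t * ∣ p ∣) tabulate-const) (count b)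
  where
  tabulate-const : tabulate {t} (λ _ → b) ≡ replicate t b
  tabulate-const = trans (tabulate-allFin (λ _ → b)) (map-const (allFin t) b)
  count : ∀ b → ∣ replicate t b ∣ + t * ∣ p ∣ ≡ t * ∣ b ∷ p ∣
  count true  = trans (cong (_+ t * ∣ p ∣) (∣⊤∣≡n t)) (sym (*-suc t ∣ p ∣))
  count false = cong (_+ t * ∣ p ∣) (∣⊥∣≡0 t)

quotient-↑ˡ : ∀ {n} t (i : Fin t) → quotient {suc n} t (i ↑ˡ (n * t)) ≡ zero
quotient-↑ˡ {n} t i rewrite splitAt-↑ˡ t i (n * t) = refl

quotient-↑ʳ : ∀ {n} t (j : Fin (n * t)) → quotient {suc n} t (t ↑ʳ j) ≡ suc (quotient {n} t j)
quotient-↑ʳ {n} t j rewrite splitAt-↑ʳ t (n * t) j = refl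

∣S∣≡t*∣X∣ : ∀ {n} t (X : Subset n) → ∣ S t X ∣ ≡ t * ∣ X ∣
∣S∣≡t*∣X∣ {zero}  t []      = sym (*-zeroʳ t)
∣S∣≡t*∣X∣ {suc n} t (b ∷ X) = begin
  ∣ S t (b ∷ X) ∣                                    ≡⟨ ∣tabulate∣-+ t _ ⟩
  ∣ tabulate (λ i → lookup (b ∷ X) (quotient t (i ↑ˡ (n * t)))) ∣ +
  ∣ tabulate (λ j → lookup (b ∷ X) (quotient t (t ↑ʳ j))) ∣
    ≡⟨ cong₂ _+_ (cong ∣_∣ (tabulate-cong (cong (lookup (b ∷ X)) ∘ quotient-↑ˡ {n} t)))
                 (cong ∣_∣ (tabulate-cong (cong (lookup (b ∷ X)) ∘ quotient-↑ʳ {n} t))) ⟩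
  ∣ tabulate {t} (λ _ → b) ∣ + ∣ S t X ∣              ≡⟨ cong (∣ tabulate {t} (λ _ → b) ∣ +_) (∣S∣≡t*∣X∣ t X) ⟩
  ∣ tabulate {t} (λ _ → b) ∣ + t * ∣ X ∣              ≡⟨ ∣tabulate-const∣ t b X ⟩
  t * ∣ b ∷ X ∣                                      ∎
  where open ≡-Reasoning

preimage : (Fin n → Fin n) → Subset n → Subset n
preimage f K = subset (λ z → f z ∈? K)

preimage⁺ : ∀ f {K} {z : Fin n} → f z ∈ K → z ∈ preimage f K
preimage⁺ f {K} = subset⁺ (λ z → f z ∈? K)

preimage⁻ : ∀ f {K} {z : Fin n} → z ∈ preimage f K → f z ∈ K
preimage⁻ f {K} = subset⁻ (λ z → f z ∈? K)

UnionIndep-preimage : ∀ {ι : Set} {N : ι → IndepSys n} (f : Fin n → Fin n) →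
                      (∀ {j I} → N j I → N j (preimage f I)) →
                      ∀ {K} → UnionIndep N K → UnionIndep N (preimage f K)
UnionIndep-preimage f preserves (Ks , Ks-indep , cover) =
  (preimage f ∘ Ks) , preserves ∘ Ks-indep , λ z → mk⇔
    (λ z∈ → let j , fz∈ = Equivalence.to (cover _) (preimage⁻ f z∈) in j , preimage⁺ f fz∈)
    (λ (j , z∈) → preimage⁺ f (Equivalence.from (cover _) (j , preimage⁻ f z∈)))

transpose-cases : ∀ (a b z : Fin n) → (z ≡ a × transpose a b z ≡ b) ⊎ (z ≢ a × z ≡ b × transpose a b z ≡ a) ⊎
                                      (z ≢ a × z ≢ b × transpose a b z ≡ z)
transpose-cases a b z with z ≟ᶠ a
... | yes z≡a = inj₁ (z≡a , refl)
... | no  z≢a with z ≟ᶠ b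
...   | yes z≡b = inj₂ (inj₁ (z≢a , z≡b , refl))
...   | no  z≢b = inj₂ (inj₂ (z≢a , z≢b , refl))

transpose-injective : ∀ (a b : Fin n) {z w} → transpose a b z ≡ transpose a b w → z ≡ w
transpose-injective a b {z} {w} eq =
  trans (sym (transpose-inverse b a)) (trans (cong (transpose b a) eq) (transpose-inverse b a))

transpose-fibre : ∀ {A : Set} (f : Fin n → A) {a b} → f a ≡ f b → ∀ z → f (transpose a b z) ≡ f z
transpose-fibre f {a} {b} fa≡fb z with transpose-cases a b z
... | inj₁ (refl , τz≡b)                = trans (cong f τz≡b) (sym fa≡fb)
... | inj₂ (inj₁ (_ , refl , τz≡a))     = trans (cong f τz≡a) fa≡fb
... | inj₂ (inj₂ (_ , _ , τz≡z))        = cong f τz≡z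

∪⁅⁆⊆preimage-transpose : ∀ {a b} {B : Subset n} → a ∉ B → b ∉ B →
                         B ∪ ⁅ a ⁆ ⊆ preimage (transpose a b) (B ∪ ⁅ b ⁆)
∪⁅⁆⊆preimage-transpose {a = a} {b} {B} a∉B b∉B {z} z∈ = preimage⁺ (transpose a b) τz∈
  where
  z∈B : z ≢ a → z ∈ B
  z∈B z≢a = [ id , (λ z≡a → ⊥-elim (z≢a z≡a)) ]′ (⁅⁆⁻ B a z∈)
  τz∈ : transpose a b z ∈ B ∪ ⁅ b ⁆
  τz∈ with transpose-cases a b z
  ... | inj₁ (_ , τz≡b)                = subst (_∈ B ∪ ⁅ b ⁆) (sym τz≡b) (⁅⁆⁺ʳ B b)
  ... | inj₂ (inj₁ (z≢a , refl , _))   = ⊥-elim (b∉B (z∈B z≢a))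
  ... | inj₂ (inj₂ (z≢a , _ , τz≡z))   = subst (_∈ B ∪ ⁅ b ⁆) (sym τz≡z) (⁅⁆⁺ˡ b (z∈B z≢a))

module Expansion (t n : ℕ) where

  β : Fin (n * t) → Fin n
  β = base {n} t

  slot : Fin (n * t) → Fin t
  slot = remainder {n} t

  β-combine : ∀ e j → β (combine e j) ≡ e
  β-combine e j = cong proj₁ (remQuot-combine {n} {t} e j)

  β-slot-injective : ∀ {x y} → β x ≡ β y → slot x ≡ slot y → x ≡ y
  β-slot-injective {x} {y} βx≡βy slotx≡sloty =
    trans (sym (combine-remQuot {n} t x)) (trans (cong₂ combine βx≡βy slotx≡sloty) (combine-remQuot {n} t y))

  S⁺ : ∀ {X x} → β x ∈ X → x ∈ S t X
  S⁺ {X} {x} βx∈X = lookup⇒[]= x _ (trans (lookup∘tabulate _ x) ([]=⇒lookup βx∈X))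

  S⁻ : ∀ {X x} → x ∈ S t X → β x ∈ X
  S⁻ {X} {x} x∈SX = lookup⇒[]= (β x) X (trans (sym (lookup∘tabulate _ x)) ([]=⇒lookup x∈SX))

  S-mono : ∀ {X Y} → X ⊆ Y → S t X ⊆ S t Y
  S-mono X⊆Y = S⁺ ∘ X⊆Y ∘ S⁻

  shadow : Subset (n * t) → Subset n
  shadow I = subset (λ e → any? (λ x → (x ∈? I) ×-dec (β x ≟ᶠ e)))

  shadow⁺ : ∀ {I x} → x ∈ I → β x ∈ shadow I
  shadow⁺ {I} {x} x∈I = subset⁺ (λ e → any? (λ x → (x ∈? I) ×-dec (β x ≟ᶠ e))) (x , x∈I , refl)

  shadow⁻ : ∀ {I e} → e ∈ shadow I → ∃ λ x → x ∈ I × β x ≡ e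
  shadow⁻ {I} = subset⁻ (λ e → any? (λ x → (x ∈? I) ×-dec (β x ≟ᶠ e)))

  shadow-mono : ∀ {I J} → I ⊆ J → shadow I ⊆ shadow J
  shadow-mono {J = J} I⊆J e∈ = let x , x∈I , βx≡e = shadow⁻ e∈ in subst (_∈ shadow J) βx≡e (shadow⁺ (I⊆J x∈I))

  shadow⊆ : ∀ {I X} → I ⊆ S t X → shadow I ⊆ X
  shadow⊆ {X = X} I⊆SX e∈ = let x , x∈I , βx≡e = shadow⁻ e∈ in subst (_∈ X) βx≡e (S⁻ (I⊆SX x∈I))

  Transversal : Subset (n * t) → Set
  Transversal I = ∀ x y → x ∈ I → y ∈ I → β x ≡ β y → x ≡ y

  Transversal? : ∀ I → Dec (Transversal I)
  Transversal? I = all? λ x → all? λ y → (x ∈? I) →-dec (y ∈? I) →-dec (β x ≟ᶠ β y) →-dec (x ≟ᶠ y)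

  Transversal-⊆ : ∀ {I J} → J ⊆ I → Transversal I → Transversal J
  Transversal-⊆ J⊆I transversal x y x∈ y∈ = transversal x y (J⊆I x∈) (J⊆I y∈)

  ∣shadow∣ : ∀ I → Transversal I → ∣ shadow I ∣ ≡ ∣ I ∣
  ∣shadow∣ I transversal = go ∣ I ∣ I refl transversal
    where
    go : ∀ c I → ∣ I ∣ ≡ c → Transversal I → ∣ shadow I ∣ ≡ c
    go zero I ∣I∣≡0 _ = Empty⇒∣p∣≡0 λ (e , e∈) →
      let x , x∈I , _ = shadow⁻ e∈ in <-irrefl (sym ∣I∣≡0) (≤-<-trans z≤n (x∈p⇒∣p-x∣<∣p∣ x∈I))
    go (suc c) I ∣I∣≡1+c transversal with 0<∣p∣⇒Nonempty I (subst (0 <_) (sym ∣I∣≡1+c) (s≤s z≤n))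
    ... | x , x∈I = begin
      ∣ shadow I ∣                    ≡⟨ cong ∣_∣ shadow-split ⟩
      ∣ shadow (I - x) ∪ ⁅ β x ⁆ ∣    ≡⟨ x∉p⇒∣p∪⁅x⁆∣≡1+∣p∣ (shadow (I - x)) (β x) βx∉ ⟩
      suc ∣ shadow (I - x) ∣          ≡⟨ cong suc (go c (I - x) ∣I-x∣≡c (Transversal-⊆ (-⁻ˡ I x) transversal)) ⟩
      suc c                           ∎
      where
      open ≡-Reasoning
      ∣I-x∣≡c : ∣ I - x ∣ ≡ c
      ∣I-x∣≡c = suc-injective (trans (x∈p⇒1+∣p-x∣≡∣p∣ I x x∈I) ∣I∣≡1+c)
      βx∉ : β x ∉ shadow (I - x)
      βx∉ βx∈ = let y , y∈ , βy≡βx = shadow⁻ βx∈ in -⁻ʳ I x y∈ (transversal y x (-⁻ˡ I x y∈) x∈I βy≡βx)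
      shadow-split : shadow I ≡ shadow (I - x) ∪ ⁅ β x ⁆
      shadow-split = ⊆-antisym
        (λ e∈ → let y , y∈I , βy≡e = shadow⁻ e∈ in case y y∈I βy≡e)
        ([ shadow-mono (-⁻ˡ I x) , (λ { refl → shadow⁺ x∈I }) ]′ ∘ ⁅⁆⁻ _ (β x))
        where
        case : ∀ {e} y → y ∈ I → β y ≡ e → e ∈ shadow (I - x) ∪ ⁅ β x ⁆
        case y y∈I refl with y ≟ᶠ x
        ... | yes refl = ⁅⁆⁺ʳ _ (β y)
        ... | no  y≢x  = ⁅⁆⁺ˡ (β x) (shadow⁺ (-⁺ y∈I y≢x))

  PLE : IndepSys n → IndepSys (n * t)
  PLE = ParallelLoopExt {n} t

  PLE⁺ : ∀ {Ind : IndepSys n} {I} → Transversal I → Ind (shadow I) → PLE Ind I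
  PLE⁺ {I = I} transversal shadow-indep =
    transversal , shadow I , (λ e → mk⇔ shadow⁻ (λ { (x , x∈I , refl) → shadow⁺ x∈I })) , shadow-indep

  PLE⁻ : ∀ (M : Matroid n) {I} → PLE (Indep M) I → Transversal I × Indep M (shadow I)
  PLE⁻ M (transversal , J , J≡ , J-indep) = transversal , indep-⊆ M (Equivalence.from (J≡ _) ∘ shadow⁻) J-indep

  Transversal-∪⁅⁆ : ∀ {I x} → Transversal I → β x ∉ shadow I → Transversal (I ∪ ⁅ x ⁆)
  Transversal-∪⁅⁆ {I} {x} transversal βx∉ y z y∈ z∈ βy≡βz with ⁅⁆⁻ I x y∈ | ⁅⁆⁻ I x z∈
  ... | inj₁ y∈I | inj₁ z∈I = transversal y z y∈I z∈I βy≡βz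
  ... | inj₂ refl | inj₂ refl = refl
  ... | inj₁ y∈I | inj₂ refl = ⊥-elim (βx∉ (subst (_∈ shadow I) βy≡βz (shadow⁺ y∈I)))
  ... | inj₂ refl | inj₁ z∈I = ⊥-elim (βx∉ (subst (_∈ shadow I) (sym βy≡βz) (shadow⁺ z∈I)))

  shadow-∪⁅⁆ : ∀ I x → shadow (I ∪ ⁅ x ⁆) ⊆ shadow I ∪ ⁅ β x ⁆
  shadow-∪⁅⁆ I x e∈ with shadow⁻ e∈
  ... | y , y∈ , refl = [ ⁅⁆⁺ˡ (β x) ∘ shadow⁺ , (λ { refl → ⁅⁆⁺ʳ _ (β y) }) ]′ (⁅⁆⁻ I x y∈)

  expand : Matroid n → Matroid (n * t)
  expand M = record
    { Indep     = PLE (Indep M)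
    ; indep?    = λ I → map′ (λ (transversal , shadow-indep) → PLE⁺ transversal shadow-indep) (PLE⁻ M)
                               (Transversal? I ×-dec indep? M (shadow I))
    ; indep-∅   = PLE⁺ (λ _ _ x∈⊥ → ⊥-elim (∉⊥ x∈⊥)) (indep-⊆ M (shadow⊆ {X = ⊥} (⊥-elim ∘ ∉⊥)) (indep-∅ M))
    ; indep-⊆   = λ J⊆I I-indep → let transversal , shadow-indep = PLE⁻ M I-indep in
                    PLE⁺ (Transversal-⊆ J⊆I transversal) (indep-⊆ M (shadow-mono J⊆I) shadow-indep)
    ; indep-aug = augment
    }
    where
    augment : ∀ {I J} → PLE (Indep M) I → PLE (Indep M) J → ∣ I ∣ < ∣ J ∣ →
              ∃ λ x → x ∈ J × x ∉ I × PLE (Indep M) (I ∪ ⁅ x ⁆)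
    augment {I} {J} I-indep J-indep ∣I∣<∣J∣ with PLE⁻ M I-indep | PLE⁻ M J-indep
    ... | I-transversal , shI-indep | J-transversal , shJ-indep
      with indep-aug M shI-indep shJ-indep
             (subst₂ _<_ (sym (∣shadow∣ I I-transversal)) (sym (∣shadow∣ J J-transversal)) ∣I∣<∣J∣)
    ... | e , e∈shJ , e∉shI , shI+e-indep with shadow⁻ e∈shJ
    ... | x , x∈J , refl =
      x , x∈J , (e∉shI ∘ shadow⁺) ,
      PLE⁺ (Transversal-∪⁅⁆ I-transversal e∉shI) (indep-⊆ M (shadow-∪⁅⁆ I x) shI+e-indep)

  PLE-bound : ∀ (M : Matroid n) {I R b} → PLE (Indep M) I → I ⊆ S t R →
              (∀ {J} → J ⊆ R → Indep M J → ∣ J ∣ ≤ b) → ∣ I ∣ ≤ b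
  PLE-bound M {I} I-indep I⊆SR bound =
    let transversal , shadow-indep = PLE⁻ M I-indep
    in subst (_≤ _) (∣shadow∣ I transversal) (bound (shadow⊆ I⊆SR) shadow-indep)

  PLE-preimage : ∀ (M : Matroid n) (f : Fin (n * t) → Fin (n * t)) → (∀ {z w} → f z ≡ f w → z ≡ w) →
                 (∀ z → β (f z) ≡ β z) → ∀ {I} → PLE (Indep M) I → PLE (Indep M) (preimage f I)
  PLE-preimage M f f-injective f-fibre {I} I-indep = let transversal , shadow-indep = PLE⁻ M I-indep in
    PLE⁺ (λ z w z∈ w∈ βz≡βw → f-injective (transversal (f z) (f w) (preimage⁻ f z∈) (preimage⁻ f w∈)
                                             (trans (f-fibre z) (trans βz≡βw (sym (f-fibre w))))))
         (indep-⊆ M ⊆shadow shadow-indep)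
    where
    ⊆shadow : shadow (preimage f I) ⊆ shadow I
    ⊆shadow e∈ = let z , z∈ , βz≡e = shadow⁻ e∈ in
      subst (_∈ shadow I) (trans (f-fibre z) βz≡e) (shadow⁺ (preimage⁻ f z∈))

  module ExpandedUnion {k} (Ms : Fin k → Matroid n) where

    N : IndepSys (n * t)
    N = UnionIndep {ι = Fin k × Fin t} (λ ij → PLE (Indep (Ms (proj₁ ij))))

    -- MatroidUnion needs a family indexed by some Fin m, so N is also read as a union over Fin (k * t).
    expanded : Fin (k * t) → Matroid (n * t)
    expanded p = expand (Ms (quotient t p))

    module N′ = MatroidUnion expanded

    N⇔N′ : ∀ {X} → N X ⇔ N′.Indep∨ X
    N⇔N′ = UnionIndep-reindex (*↔× {k} {t}) (λ ij → PLE (Indep (Ms (proj₁ ij))))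

    S-⋃ᶠ-indep : ∀ {Is} → (∀ i → Indep (Ms i) (Is i)) → N (S t (⋃ᶠ Is))
    S-⋃ᶠ-indep {Is} Is-indep = parts , parts-indep , cover
      where
      part? : ∀ ij x → Dec (β x ∈ Is (proj₁ ij) × slot x ≡ proj₂ ij)
      part? (i , j) x = (β x ∈? Is i) ×-dec (slot x ≟ᶠ j)
      parts : Fin k × Fin t → Subset (n * t)
      parts ij = subset (part? ij)
      parts-indep : ∀ ij → PLE (Indep (Ms (proj₁ ij))) (parts ij)
      parts-indep (i , j) = PLE⁺
        (λ x y x∈ y∈ βx≡βy → β-slot-injective βx≡βy
          (trans (proj₂ (subset⁻ (part? (i , j)) x∈)) (sym (proj₂ (subset⁻ (part? (i , j)) y∈)))))
        (indep-⊆ (Ms i) (λ e∈ → let x , x∈ , βx≡e = shadow⁻ e∈ in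
                                 subst (_∈ Is i) βx≡e (proj₁ (subset⁻ (part? (i , j)) x∈)))
                        (Is-indep i))
      cover : ∀ x → x ∈ S t (⋃ᶠ Is) ⇔ ∃ λ ij → x ∈ parts ij
      cover x = mk⇔
        (λ x∈ → let i , βx∈Isᵢ = ⋃ᶠ⁻ Is (S⁻ x∈) in (i , slot x) , subset⁺ (part? (i , slot x)) (βx∈Isᵢ , refl))
        (λ (ij , x∈) → S⁺ (⋃ᶠ⁺ Is (proj₁ ij) (proj₁ (subset⁻ (part? ij) x∈))))

    expansion-bound : ∀ {Is} → Disjoint Is → ∀ {R} →
                      (∀ i {J} → J ⊆ R → Indep (Ms i) J → ∣ J ∣ ≤ ∣ Is i ∩ R ∣) →
                      ∀ {K} → N K → ∣ K ∩ S t R ∣ ≤ t * ∣ ⋃ᶠ Is ∩ R ∣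
    expansion-bound {Is} disjoint {R} bound {K} (Ks , Ks-indep , cover) = begin
      ∣ K ∩ S t R ∣                       ≤⟨ p⊆q⇒∣p∣≤∣q∣ K∩SR⊆ ⟩
      ∣ ⋃ᶠ (λ i → ⋃ᶠ (G i)) ∣             ≤⟨ ∣⋃ᶠ∣≤∑ (λ i → ⋃ᶠ (G i)) ⟩
      ∑[ i < k ] ∣ ⋃ᶠ (G i) ∣             ≤⟨ ∑-mono-≤ (λ i → ∣⋃ᶠ∣≤∑ (G i)) ⟩
      ∑[ i < k ] ∑[ j < t ] ∣ G i j ∣     ≤⟨ ∑-mono-≤ (λ i → ∑-mono-≤ (λ j → Gᵢⱼ-bound i j)) ⟩
      ∑[ i < k ] ∑[ j < t ] ∣ Is i ∩ R ∣  ≡⟨ sum-cong-≗ (λ i → ∑-const t ∣ Is i ∩ R ∣) ⟩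
      ∑[ i < k ] (t * ∣ Is i ∩ R ∣)       ≡⟨ *-distribˡ-sum t (λ i → ∣ Is i ∩ R ∣) ⟨
      t * ∑[ i < k ] ∣ Is i ∩ R ∣         ≡⟨ cong (t *_) (Disjoint⇒∑∣∩∣≡∣⋃ᶠ∩∣ Is R disjoint) ⟩
      t * ∣ ⋃ᶠ Is ∩ R ∣                   ∎
      where
      open ≤-Reasoning
      G : Fin k → Fin t → Subset (n * t)
      G i j = Ks (i , j) ∩ S t R
      K∩SR⊆ : K ∩ S t R ⊆ ⋃ᶠ (λ i → ⋃ᶠ (G i))
      K∩SR⊆ x∈ = let x∈K , x∈SR = x∈p∩q⁻ K (S t R) x∈
                     (i , j) , x∈Ksᵢⱼ = Equivalence.to (cover _) x∈K
                 in ⋃ᶠ⁺ _ i (⋃ᶠ⁺ (G i) j (∩⁺ x∈Ksᵢⱼ x∈SR))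
      Gᵢⱼ-bound : ∀ i j → ∣ G i j ∣ ≤ ∣ Is i ∩ R ∣
      Gᵢⱼ-bound i j =
        PLE-bound (Ms i) (indep-⊆ (expand (Ms i)) (p∩q⊆p _ _) (Ks-indep (i , j))) (p∩q⊆q _ _) (bound i)

    transpose-indep : ∀ {a b} → β a ≡ β b → ∀ {K} → N K → N (preimage (transpose a b) K)
    transpose-indep {a} {b} βa≡βb =
      UnionIndep-preimage {N = λ ij → PLE (Indep (Ms (proj₁ ij)))} (transpose a b) λ {ij} →
        PLE-preimage (Ms (proj₁ ij)) (transpose a b) (transpose-injective a b) (transpose-fibre β βa≡βb)

    N-⊆ : ∀ {I J} → J ⊆ I → N I → N J
    N-⊆ J⊆I = Equivalence.from N⇔N′ ∘ N′.Indep∨-⊆ J⊆I ∘ Equivalence.to N⇔N′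

    N-maximal⇒Rank : ∀ {X I} → I ⊆ X → N I → (∀ y → y ∈ X → y ∉ I → ¬ N (I ∪ ⁅ y ⁆)) → Rank N X ∣ I ∣
    N-maximal⇒Rank I⊆X I-indep maximal =
      Rank-⇔ (λ {X} → ⇔-sym N⇔N′)
        (N′.maximal⇒Rank I⊆X (Equivalence.to N⇔N′ I-indep)
                          λ y y∈X y∉I → maximal y y∈X y∉I ∘ Equivalence.from N⇔N′)

    N-BasisOf⇒Rank : ∀ {F B} → BasisOf N F B → Rank N F ∣ B ∣
    N-BasisOf⇒Rank basis@(B⊆F , B-indep , _) = N-maximal⇒Rank B⊆F B-indep (BasisOf-maximal basis)

    N-Rank : ∀ X → Rank N X (N′.rank X)
    N-Rank X = Rank-⇔ (λ {X} → ⇔-sym N⇔N′) (N′.Rank-rank X)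

    S-indep : ∀ {B} → UnionIndep (Indep ∘ Ms) B → N (S t B)
    S-indep (Bs , Bs-indep , cover) =
      N-⊆ (S-mono λ e∈B → let i , e∈Bsᵢ = Equivalence.to (cover _) e∈B in ⋃ᶠ⁺ Bs i e∈Bsᵢ) (S-⋃ᶠ-indep Bs-indep)

-- The expansion of a matroid union

module ExpansionOfUnion (t′ n k : ℕ) (Ms : Fin k → Matroid n) where

  t : ℕ
  t = suc t′

  open Expansion t n
  open ExpandedUnion Ms
  module M = MatroidUnion Ms

  -- The slack Z lets one bound cover both K ⊆ S_X (Z = ⊥) and K ⊆ S_A - x (Z = S_e - x).
  N-bound : ∀ X {Z K} → K ⊆ S t X ∪ Z → N K → ∣ K ∣ ≤ t * M.rank X + ∣ Z ∣
  N-bound X {Z} {K} K⊆ K-indep = begin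
    ∣ K ∣                                                ≡⟨ ∣p∣≡∣p∩q∣+∣p─q∣ K (S t R) ⟩
    ∣ K ∩ S t R ∣ + ∣ K ─ S t R ∣
      ≤⟨ +-mono-≤ (expansion-bound disjoint bound K-indep) outside ⟩
    t * ∣ ⋃ᶠ parts ∩ R ∣ + (t * ∣ ⋃ᶠ parts ─ R ∣ + ∣ Z ∣) ≡⟨ +-assoc (t * ∣ ⋃ᶠ parts ∩ R ∣) _ ∣ Z ∣ ⟨
    t * ∣ ⋃ᶠ parts ∩ R ∣ + t * ∣ ⋃ᶠ parts ─ R ∣ + ∣ Z ∣
      ≡⟨ cong (_+ ∣ Z ∣) (*-distribˡ-+ t ∣ ⋃ᶠ parts ∩ R ∣ _) ⟨
    t * (∣ ⋃ᶠ parts ∩ R ∣ + ∣ ⋃ᶠ parts ─ R ∣) + ∣ Z ∣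
      ≡⟨ cong (λ c → t * c + ∣ Z ∣) (∣p∣≡∣p∩q∣+∣p─q∣ (⋃ᶠ parts) R) ⟨
    t * M.rank X + ∣ Z ∣                                 ∎
    where
    open ≤-Reasoning
    open M.Optimal (M.optimal X)
    open M.Certificate certificate
    K─SR⊆ : K ─ S t R ⊆ S t (⋃ᶠ parts ─ R) ∪ Z
    K─SR⊆ x∈ with ∪⁻ _ Z (K⊆ (─⁻ˡ K _ x∈))
    ... | inj₂ x∈Z  = ∪⁺ʳ _ x∈Z
    ... | inj₁ x∈SX = let βx∉R = ─⁻ʳ K _ x∈ ∘ S⁺ in ∪⁺ˡ Z (S⁺ (─⁺ (covers (S⁻ x∈SX) βx∉R) βx∉R))
    outside : ∣ K ─ S t R ∣ ≤ t * ∣ ⋃ᶠ parts ─ R ∣ + ∣ Z ∣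
    outside = ≤-trans (p⊆q⇒∣p∣≤∣q∣ K─SR⊆)
      (≤-trans (∣p∪q∣≤∣p∣+∣q∣ (S t (⋃ᶠ parts ─ R)) Z)
               (≤-reflexive (cong (_+ ∣ Z ∣) (∣S∣≡t*∣X∣ t (⋃ᶠ parts ─ R)))))

  S-rank : ∀ {A a} → Rank M.Indep∨ A a → Rank N (S t A) (t * a)
  S-rank {A} rank-a = subst (Rank N (S t A) ∘ (t *_)) (Rank-unique (M.Rank-rank A) rank-a)
    ( (S t (M.basis A) , S-mono (M.basis⊆ A) , S-indep (M.basis-indep A) , ∣S∣≡t*∣X∣ t (M.basis A))
    , λ K K⊆SA K-indep → ≤-trans (N-bound A (∪⁺ˡ ⊥ ∘ K⊆SA) K-indep)
                                 (≤-reflexive (trans (cong (t * M.rank A +_) (∣⊥∣≡0 (n * t))) (+-identityʳ _))))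

  N-bound-without : ∀ {A e x K} → e ∈ A → β x ≡ e → K ⊆ S t A → x ∉ K → N K →
                    ∣ K ∣ < t * suc (M.rank (A - e))
  N-bound-without {A} {e} {x} {K} e∈A βx≡e K⊆SA x∉K K-indep = begin-strict
    ∣ K ∣                                    ≤⟨ N-bound (A - e) K⊆ K-indep ⟩
    t * M.rank (A - e) + ∣ S t ⁅ e ⁆ - x ∣   <⟨ +-monoʳ-< (t * M.rank (A - e)) ∣Sₑ-x∣<t ⟩
    t * M.rank (A - e) + t                   ≡⟨ +-comm _ t ⟩
    t + t * M.rank (A - e)                   ≡⟨ *-suc t _ ⟨
    t * suc (M.rank (A - e))                 ∎
    where
    open ≤-Reasoning
    K⊆ : K ⊆ S t (A - e) ∪ (S t ⁅ e ⁆ - x)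
    K⊆ {z} z∈K with β z ≟ᶠ e
    ... | yes βz≡e = ∪⁺ʳ _ (-⁺ (S⁺ (subst (_∈ ⁅ e ⁆) (sym βz≡e) (x∈⁅x⁆ e))) λ { refl → x∉K z∈K })
    ... | no  βz≢e = ∪⁺ˡ (S t ⁅ e ⁆ - x) (S⁺ {A - e} (-⁺ (S⁻ (K⊆SA z∈K)) βz≢e))
    ∣Sₑ-x∣<t : ∣ S t ⁅ e ⁆ - x ∣ < t
    ∣Sₑ-x∣<t = subst (∣ S t ⁅ e ⁆ - x ∣ <_)
                 (trans (∣S∣≡t*∣X∣ t ⁅ e ⁆) (trans (cong (t *_) (∣⁅x⁆∣≡1 e)) (*-identityʳ t)))
                 (x∈p⇒∣p-x∣<∣p∣ (S⁺ (subst (_∈ ⁅ e ⁆) (sym βx≡e) (x∈⁅x⁆ e))))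

  S-BasisOf : ∀ {A B} → BasisOf M.Indep∨ A B → BasisOf N (S t A) (S t B)
  S-BasisOf {A} {B} basis@(B⊆A , B-indep , _) = maximum⇒BasisOf (S-mono B⊆A) (S-indep B-indep)
    λ J J⊆SA J-indep →
      subst (∣ J ∣ ≤_) (sym (∣S∣≡t*∣X∣ t B)) (proj₂ (S-rank (M.BasisOf⇒Rank basis)) J J⊆SA J-indep)

  S-Flat⁺ : ∀ {A} → Flat M.Indep∨ A → Flat N (S t A)
  S-Flat⁺ {A} A-flat y y∉SA k k′ rank-k rank-k′ = begin-strict
    k                    ≡⟨ Rank-unique rank-k (S-rank (M.Rank-rank A)) ⟩
    t * M.rank A         <⟨ s≤s (*-monoʳ-≤ t rA≤∣B-e∣) ⟩
    suc (t * ∣ B - e ∣)  ≡⟨ cong suc (∣S∣≡t*∣X∣ t (B - e)) ⟨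
    suc ∣ S t (B - e) ∣  ≡⟨ x∉p⇒∣p∪⁅x⁆∣≡1+∣p∣ (S t (B - e)) y (λ y∈ → -⁻ʳ B e (S⁻ y∈) refl) ⟨
    ∣ K ∣                ≤⟨ proj₂ rank-k′ K (∪⁅⁆-mono y (S-mono B-e⊆A)) K-indep ⟩
    k′                   ∎
    where
    open ≤-Reasoning
    e : Fin n
    e = β y
    e∉A : e ∉ A
    e∉A = y∉SA ∘ S⁺
    B : Subset n
    B = M.basis (A ∪ ⁅ e ⁆)
    B-e⊆A : B - e ⊆ A
    B-e⊆A z∈ = [ id , (λ { refl → ⊥-elim (-⁻ʳ B _ z∈ refl) }) ]′ (⁅⁆⁻ A e (M.basis⊆ _ (-⁻ˡ B e z∈)))
    rA<∣B∣ : M.rank A < ∣ B ∣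
    rA<∣B∣ = A-flat e e∉A _ _ (M.Rank-rank A) (M.Rank-rank (A ∪ ⁅ e ⁆))
    e∈B : e ∈ B
    e∈B with e ∈? B
    ... | yes e∈B = e∈B
    ... | no  e∉B = ⊥-elim (<⇒≱ rA<∣B∣ (proj₂ (M.Rank-rank A) B B⊆A (M.basis-indep _)))
      where
      B⊆A : B ⊆ A
      B⊆A z∈B = [ id , (λ { refl → ⊥-elim (e∉B z∈B) }) ]′ (⁅⁆⁻ A e (M.basis⊆ _ z∈B))
    rA≤∣B-e∣ : M.rank A ≤ ∣ B - e ∣
    rA≤∣B-e∣ = ≤-pred (<-≤-trans rA<∣B∣ (≤-reflexive (sym (x∈p⇒1+∣p-x∣≡∣p∣ B e e∈B))))
    K : Subset (n * t)
    K = S t (B - e) ∪ ⁅ y ⁆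
    K-indep : N K
    K-indep = N-⊆ ([ S-mono (-⁻ˡ B e) , (λ { refl → S⁺ e∈B }) ]′ ∘ ⁅⁆⁻ _ y) (S-indep (M.basis-indep _))

  S-Flat⁻ : ∀ {A} → Flat N (S t A) → Flat M.Indep∨ A
  S-Flat⁻ {A} SA-flat e e∉A a b rank-a rank-b = *-cancelˡ-< t a b (begin-strict
    t * a                     <⟨ SA-flat e₀ e₀∉SA _ _ (S-rank rank-a) (N-Rank (S t A ∪ ⁅ e₀ ⁆)) ⟩
    N′.rank (S t A ∪ ⁅ e₀ ⁆)  ≤⟨ Rank-mono SA+e₀⊆ (N-Rank _) (S-rank rank-b) ⟩
    t * b                     ∎)
    where
    open ≤-Reasoning
    e₀ : Fin (n * t)
    e₀ = combine e zero
    βe₀≡e : β e₀ ≡ e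
    βe₀≡e = β-combine e zero
    e₀∉SA : e₀ ∉ S t A
    e₀∉SA e₀∈ = e∉A (subst (_∈ A) βe₀≡e (S⁻ e₀∈))
    SA+e₀⊆ : S t A ∪ ⁅ e₀ ⁆ ⊆ S t (A ∪ ⁅ e ⁆)
    SA+e₀⊆ = [ S-mono {A} (⁅⁆⁺ˡ e) , (λ { refl → S⁺ (subst (_∈ A ∪ ⁅ e ⁆) (sym βe₀≡e) (⁅⁆⁺ʳ A e)) }) ]′
           ∘ ⁅⁆⁻ (S t A) e₀

  S-coloop-free⁺ : ∀ {A} → (∀ e → ¬ ColoopOfRestriction M.Indep∨ A e) →
                   ∀ x → ¬ ColoopOfRestriction N (S t A) x
  S-coloop-free⁺ coloop-free x (x∈SA , in-every-basis) =
    coloop-free (β x) (S⁻ x∈SA , λ B basis → S⁻ (in-every-basis (S t B) (S-BasisOf basis)))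

  S-coloop-free⁻ : ∀ {A} → (∀ x → ¬ ColoopOfRestriction N (S t A) x) →
                   ∀ e → ¬ ColoopOfRestriction M.Indep∨ A e
  S-coloop-free⁻ {A} coloop-free e (e∈A , in-every-basis) =
    coloop-free e₀ (S⁺ (subst (_∈ A) (sym (β-combine e zero)) e∈A) , in-every-N-basis)
    where
    e₀ : Fin (n * t)
    e₀ = combine e zero
    B′ : Subset n
    B′ = M.basis (A - e)
    e∉B′ : e ∉ B′
    e∉B′ e∈ = -⁻ʳ A e (M.basis⊆ (A - e) e∈) refl
    in-every-N-basis : ∀ B → BasisOf N (S t A) B → e₀ ∈ B
    in-every-N-basis B basis@(B⊆SA , B-indep , _) with e₀ ∈? B
    ... | yes e₀∈B = e₀∈B
    ... | no  e₀∉B = ⊥-elim (e∉B′ (in-every-basis B′ B′-basis))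
      where
      rA≤rA-e : M.rank A ≤ M.rank (A - e)
      rA≤rA-e = ≤-pred (*-cancelˡ-< t _ _ (begin-strict
        t * M.rank A              ≡⟨ Rank-unique (S-rank (M.Rank-rank A)) (N-BasisOf⇒Rank basis) ⟩
        ∣ B ∣                     <⟨ N-bound-without e∈A (β-combine e zero) B⊆SA e₀∉B B-indep ⟩
        t * suc (M.rank (A - e))  ∎))
        where open ≤-Reasoning
      B′-basis : BasisOf M.Indep∨ A B′
      B′-basis = maximum⇒BasisOf (-⁻ˡ A e ∘ M.basis⊆ (A - e)) (M.basis-indep _)
        λ J J⊆A J-indep → ≤-trans (proj₂ (M.Rank-rank A) J J⊆A J-indep) rA≤rA-e

  -- Transposing x and y shows that a basis of F avoiding x would stay maximal in F ∪ ⁅ y ⁆.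
  Flat-fibre-coloop : ∀ {F x y} → Flat N F → x ∈ F → y ∉ F → β x ≡ β y → ColoopOfRestriction N F x
  Flat-fibre-coloop {F} {x} {y} F-flat x∈F y∉F βx≡βy = x∈F , in-every-basis
    where
    in-every-basis : ∀ B → BasisOf N F B → x ∈ B
    in-every-basis B basis@(B⊆F , B-indep , _) with x ∈? B
    ... | yes x∈B = x∈B
    ... | no  x∉B = ⊥-elim (<-irrefl refl (F-flat y y∉F _ _ (N-BasisOf⇒Rank basis)
                                              (N-maximal⇒Rank (⁅⁆⁺ˡ y ∘ B⊆F) B-indep maximal)))
      where
      B+y-dependent : ¬ N (B ∪ ⁅ y ⁆)
      B+y-dependent B+y-indep = BasisOf-maximal basis x x∈F x∉B
        (N-⊆ (∪⁅⁆⊆preimage-transpose x∉B (y∉F ∘ B⊆F)) (transpose-indep βx≡βy B+y-indep))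
      maximal : ∀ z → z ∈ F ∪ ⁅ y ⁆ → z ∉ B → ¬ N (B ∪ ⁅ z ⁆)
      maximal z z∈ z∉B with ⁅⁆⁻ F y z∈
      ... | inj₁ z∈F = BasisOf-maximal basis z z∈F z∉B
      ... | inj₂ refl = B+y-dependent

  CyclicFlat-saturated : ∀ {F} → CyclicFlat N F → F ≡ S t (shadow F)
  CyclicFlat-saturated {F} (F-flat , coloop-free) = ⊆-antisym (S⁺ ∘ shadow⁺) saturated
    where
    saturated : S t (shadow F) ⊆ F
    saturated {y} y∈ with y ∈? F | shadow⁻ (S⁻ y∈)
    ... | yes y∈F | _ = y∈F
    ... | no  y∉F | x , x∈F , βx≡βy = ⊥-elim (coloop-free x (Flat-fibre-coloop F-flat x∈F y∉F βx≡βy))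

  S-CyclicFlat⁺ : ∀ {A} → CyclicFlat M.Indep∨ A → CyclicFlat N (S t A)
  S-CyclicFlat⁺ (A-flat , coloop-free) = S-Flat⁺ A-flat , S-coloop-free⁺ coloop-free

  S-CyclicFlat⁻ : ∀ {A} → CyclicFlat N (S t A) → CyclicFlat M.Indep∨ A
  S-CyclicFlat⁻ (SA-flat , coloop-free) = S-Flat⁻ SA-flat , S-coloop-free⁻ coloop-free

theorem3p11 : (t : ℕ) → 1 ≤ t → (n k : ℕ) → 1 ≤ k → (Ms : Fin k → Matroid n) →
    IsExpansion t (UnionIndep (λ i → Indep (Ms i)))
      (UnionIndep {ι = Fin k × Fin t} (λ ij → ParallelLoopExt t (Indep (Ms (proj₁ ij)))))
theorem3p11 (suc t′) _ n k _ Ms =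
  (λ F → mk⇔
    (λ F-cyclic → let F≡S = CyclicFlat-saturated F-cyclic in
      shadow F , S-CyclicFlat⁻ (subst (CyclicFlat N) F≡S F-cyclic) , F≡S)
    (λ { (A , A-cyclic , refl) → S-CyclicFlat⁺ A-cyclic })) ,
  λ A _ a → S-rank
  where
  open ExpansionOfUnion t′ n k Ms
  open Expansion t n
  open ExpandedUnion Ms
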